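{- For all $n\ge 1$, $\overline{C}_{12,3}(n)\equiv 1\pmod 2$ if $3n+1$ is a perfect square, and $\overline{C}_{12,3}(n)\equiv 0\pmod 2$ otherwise.
   Context: An overpartition of $n$ is a non-increasing sequence of positive integers summing to $n$ in which the first occurrence of each distinct number may be overlined. $\overline{C}_{12,3}(n)$ is the number of overpartitions of $n$ in which no part is divisible by $12$ and only parts congruent to $\pm 3\pmod{12}$ may be overlined; equivalently $\sum_{n\ge0}\overline{C}_{12,3}(n)q^n=\frac{(q^{12};q^{12})_\infty(-q^3;q^{12})_\infty(-q^{9};q^{12})_\infty}{(q;q)_\infty}$, where $(x;q)_\infty=\prod_{j\ge0}(1-xq^j)$. -}

module Defs where

open import Data.Nat using (ℕ; zero; suc; _+_; _*_; _∸_; _≤ᵇ_; _≡ᵇ_; _%_)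
open import Data.Bool using (Bool; true; false; if_then_else_; _∨_)
open import Data.List using (List; map; upTo)
open import Data.Nat.ListAction using (sum)

-- Number of ways to use the part size p exactly m times in an overpartition
-- counted by C̄_{12,3}:
--  * m = 0 : one way (part absent);
--  * m ≥ 1 and 12 ∣ p : forbidden (no part divisible by 12);
--  * m ≥ 1 and p ≡ ±3 (mod 12) : two ways (first occurrence overlined or not);
--  * m ≥ 1 otherwise : one way (overlining not allowed).
weight : ℕ → ℕ → ℕ
weight p zero    = 1
weight p (suc _) =
  if (p % 12) ≡ᵇ 0 then 0
  else if ((p % 12) ≡ᵇ 3) ∨ ((p % 12) ≡ᵇ 9) then 2
  else 1

-- ovCount k n = number of overpartitions of n, all of whose parts are ≤ k,
-- with no part divisible by 12 and only parts ≡ ±3 (mod 12) allowed to be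
-- overlined.
ovCount : ℕ → ℕ → ℕ
ovCount zero    n = if n ≡ᵇ 0 then 1 else 0
ovCount (suc k) n =
  sum (map (λ m → if m * suc k ≤ᵇ n
                    then weight (suc k) m * ovCount k (n ∸ m * suc k)
                    else 0)
           (upTo (suc n)))

-- C̄_{12,3}(n): parts of an overpartition of n are at most n.
Cbar12-3 : ℕ → ℕ
Cbar12-3 n = ovCount n n

-- Mod 2 the generating function G of C̄_{12,3} is a product ∏ (1 + q^p)^(-e p), e p being the
-- parity of the weight of a part p, and we show G ≡ Σ_{j ∈ ℤ} q^(3j^2 + 2j). Since 3j^2 + 2j = n
-- exactly when (3j + 1)^2 = 3n + 1, and j ↦ |3j + 1| is a bijection onto the naturals prime to 3,
-- this is the claim.
--
-- Products F = ∏ (1 + q^a)^(μ a) are shown ≡ 1 by descent: writing μ = μ₁ + 2μ₂ and using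
-- (1 + q^a)^2 ≡ 1 + q^(2a), F ≡ ∏ (1 + q^a)^(μ₁ a) (1 + q^(2a))^(μ₂ a); when the exponents are
-- arranged so that this is F(q^2), F agrees with F(q^2) in low degrees and hence F ≡ 1 there.
-- This gives G (q^6;q^6)(q;q^6)(q^5;q^6) ≡ 1 and (q^6;q^6)(q^3;q^6)^2 ≡ 1.
--
-- The finite triple product T_K(z) = ∏_{k<K} (1 + z q^(6k+3)) (1 + z⁻¹ q^(6k+3)) satisfies a
-- functional equation under z ↦ z q^6 showing that, in degrees ≤ 6K, the coefficient of z^j is
-- q^(3j^2) times that of z^0. At z = 1 the rows ±j cancel in pairs, so T_K(1) = (q^3;q^6)^2 is the
-- z^0 row, and at z = q^2 this gives (q;q^6)(q^5;q^6) ≡ (q^3;q^6)^2 Σ_j q^(3j^2 + 2j).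
-- Combining, G ≡ Σ_j q^(3j^2 + 2j).

module Submission where

open import Defs
open import Data.Bool using (Bool; true; false; _xor_; _∧_; _∨_; not; if_then_else_; T)
open import Data.Bool.Properties using (xor-assoc; xor-comm; xor-same; xor-identityʳ; not-distribˡ-xor; not-involutive; T-≡)
open import Data.Empty using (⊥; ⊥-elim)
open import Data.Nat using (ℕ; zero; suc; _+_; _*_; _∸_; _%_; _/_; _≤_; _<_; _≟_; _≤ᵇ_; _≡ᵇ_; z≤n; s≤s)
import Data.Nat.Properties as ℕP
open import Data.Nat.DivMod using ([m+kn]%n≡m%n; m%n<n; m≡m%n+[m/n]*n; m%n%n≡m%n)
import Data.Nat.Tactic.RingSolver as ℕ-Solver
open import Data.Fin using (Fin; toℕ; fromℕ<)
open import Data.Fin.Properties using (toℕ-fromℕ<; all?)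
open import Data.List using (List; []; _∷_; map; applyUpTo)
open import Data.Nat.ListAction using (sum)
open import Data.Nat.Induction using (<-rec)
open import Data.Integer as ℤ using (ℤ; +_; -[1+_]; _-_; -_; _⊖_; 0ℤ)
import Data.Integer.Properties as ℤP
open import Data.Integer.Tactic.RingSolver using (solve-∀)
open import Data.Product using (∃; _,_; _×_; proj₁; proj₂)
open import Data.Sum using (_⊎_; inj₁; inj₂)
open import Function using (_∘_; Equivalence)
open import Relation.Binary.PropositionalEquality
open import Relation.Binary.Definitions using (tri<; tri≈; tri>)
open import Relation.Nullary using (¬_; Dec; yes; no)
open import Relation.Nullary.Decidable using (from-yes; _×-dec_)

xor-cancelˡ : ∀ x y → x xor (x xor y) ≡ y
xor-cancelˡ x y = trans (sym (xor-assoc x x y)) (cong (_xor y) (xor-same x))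

xor-interchange : ∀ a b c d → (a xor b) xor (c xor d) ≡ (a xor c) xor (b xor d)
xor-interchange a b c d = begin
  (a xor b) xor (c xor d)   ≡⟨ xor-assoc a b (c xor d) ⟩
  a xor (b xor (c xor d))   ≡⟨ cong (a xor_) (sym (xor-assoc b c d)) ⟩
  a xor ((b xor c) xor d)   ≡⟨ cong (λ x → a xor (x xor d)) (xor-comm b c) ⟩
  a xor ((c xor b) xor d)   ≡⟨ cong (a xor_) (xor-assoc c b d) ⟩
  a xor (c xor (b xor d))   ≡⟨ sym (xor-assoc a c (b xor d)) ⟩
  (a xor c) xor (b xor d)   ∎
  where open ≡-Reasoning

xorBelow : (ℕ → Bool) → ℕ → Bool
xorBelow f zero    = false
xorBelow f (suc L) = f 0 xor xorBelow (f ∘ suc) L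

xorBelow-cong : ∀ {f g} L → (∀ m → m < L → f m ≡ g m) → xorBelow f L ≡ xorBelow g L
xorBelow-cong zero    f≡g = refl
xorBelow-cong (suc L) f≡g = cong₂ _xor_ (f≡g 0 (s≤s z≤n)) (xorBelow-cong L (λ m m<L → f≡g (suc m) (s≤s m<L)))

xorBelow-snoc : ∀ f L → xorBelow f (suc L) ≡ xorBelow f L xor f L
xorBelow-snoc f zero    = xor-comm (f 0) false
xorBelow-snoc f (suc L) = trans (cong (f 0 xor_) (xorBelow-snoc (f ∘ suc) L)) (sym (xor-assoc (f 0) _ _))

xorBelow-false : ∀ f L → (∀ m → m < L → f m ≡ false) → xorBelow f L ≡ false
xorBelow-false f zero    f≡false = refl
xorBelow-false f (suc L) f≡false rewrite f≡false 0 (s≤s z≤n) =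
  xorBelow-false (f ∘ suc) L (λ m m<L → f≡false (suc m) (s≤s m<L))

xorBelow-beyond : ∀ f n → (∀ m → n < m → f m ≡ false) → ∀ d → xorBelow f (suc n + d) ≡ xorBelow f (suc n)
xorBelow-beyond f n beyond zero    rewrite ℕP.+-identityʳ n = refl
xorBelow-beyond f n beyond (suc d) rewrite ℕP.+-suc n d =
  trans (xorBelow-snoc f (suc (n + d)))
        (trans (cong₂ _xor_ (xorBelow-beyond f n beyond d) (beyond _ (s≤s (ℕP.m≤m+n n d)))) (xor-identityʳ _))

xorBelow-true : ∀ f L → xorBelow f L ≡ true → ∃ λ m → f m ≡ true
xorBelow-true f (suc L) odd with f 0 in f0
... | true  = 0 , f0
... | false with xorBelow-true (f ∘ suc) L odd
...   | m , fm = suc m , fm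

xorBelow-single : ∀ f L k → f k ≡ true → (∀ m → m ≢ k → f m ≡ false) → k < L → xorBelow f L ≡ true
xorBelow-single f (suc L) zero    fk others _ =
  cong₂ _xor_ fk (xorBelow-false (f ∘ suc) L (λ m _ → others (suc m) (λ ())))
xorBelow-single f (suc L) (suc k) fk others (s≤s k<L) =
  cong₂ _xor_ (others 0 (λ ())) (xorBelow-single (f ∘ suc) L k fk (λ m m≢k → others (suc m) (m≢k ∘ ℕP.suc-injective)) k<L)

-- Series mod 2 and products of binomials

-- The coefficients mod 2 of a Laurent series in q.
Series : Set
Series = ℤ → Bool

one : Series
one (+ zero) = true
one _        = false

record PowerSeries (f : Series) : Set where
  constructor powerSeries
  field below : ∀ d → f -[1+ d ] ≡ false
open PowerSeries

AgreeUpTo : ℤ → Series → Series → Set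
AgreeUpTo B f g = ∀ m → m ℤ.≤ B → f m ≡ g m

-- mulBin c f = (1 + q^c) f, powBin e c f = (1 + q^c)^e f and
-- prodBin e K f = (∏_{a = 1}^{K} (1 + q^a)^(e a)) f.
mulBin : ℕ → Series → Series
mulBin c f m = f m xor f (m - + c)

powBin : ℕ → ℕ → Series → Series
powBin zero    c f = f
powBin (suc e) c f = mulBin c (powBin e c f)

prodBin : (ℕ → ℕ) → ℕ → Series → Series
prodBin e zero    f = f
prodBin e (suc K) f = powBin (e (suc K)) (suc K) (prodBin e K f)

_⊞_ : (ℕ → ℕ) → (ℕ → ℕ) → ℕ → ℕ
(e ⊞ e′) a = e a + e′ a

mulBin-cong : ∀ c {f g} → f ≗ g → mulBin c f ≗ mulBin c g
mulBin-cong c f≗g m = cong₂ _xor_ (f≗g m) (f≗g (m - + c))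

mulBin-comm : ∀ a b f → mulBin a (mulBin b f) ≗ mulBin b (mulBin a f)
mulBin-comm a b f m =
  trans (xor-interchange (f m) (f (m - + b)) (f (m - + a)) (f ((m - + a) - + b)))
        (cong (λ x → (f m xor f (m - + a)) xor (f (m - + b) xor f x)) (sub-swap m (+ a) (+ b)))
  where
  sub-swap : ∀ m x y → (m - x) - y ≡ (m - y) - x
  sub-swap = solve-∀

mulBin-square : ∀ a f → mulBin a (mulBin a f) ≗ mulBin (a + a) f
mulBin-square a f m =
  trans (xor-assoc (f m) (f (m - + a)) _)
        (cong (f m xor_) (trans (xor-cancelˡ (f (m - + a)) _) (cong f (sub-twice m (+ a)))))
  where
  sub-twice : ∀ m x → (m - x) - x ≡ m - (x ℤ.+ x)
  sub-twice = solve-∀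

powBin-cong : ∀ e c {f g} → f ≗ g → powBin e c f ≗ powBin e c g
powBin-cong zero    c f≗g = f≗g
powBin-cong (suc e) c f≗g = mulBin-cong c (powBin-cong e c f≗g)

powBin-mulBin : ∀ e a b f → powBin e a (mulBin b f) ≗ mulBin b (powBin e a f)
powBin-mulBin zero    a b f m = refl
powBin-mulBin (suc e) a b f m =
  trans (mulBin-cong a (powBin-mulBin e a b f) m) (mulBin-comm a b (powBin e a f) m)

powBin-comm : ∀ e e′ a b f → powBin e a (powBin e′ b f) ≗ powBin e′ b (powBin e a f)
powBin-comm e zero     a b f m = refl
powBin-comm e (suc e′) a b f m =
  trans (powBin-mulBin e a b (powBin e′ b f) m) (mulBin-cong b (powBin-comm e e′ a b f) m)

powBin-+ : ∀ e e′ c f → powBin e c (powBin e′ c f) ≗ powBin (e + e′) c f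
powBin-+ zero    e′ c f m = refl
powBin-+ (suc e) e′ c f m = mulBin-cong c (powBin-+ e e′ c f) m

powBin-double : ∀ e a {c} f → c ≡ a + a → powBin (e + e) a f ≗ powBin e c f
powBin-double zero    a f refl m = refl
powBin-double (suc e) a f refl m rewrite ℕP.+-suc e e =
  trans (mulBin-square a (powBin (e + e) a f) m) (mulBin-cong (a + a) (powBin-double e a f refl) m)

powBin-exp : ∀ {e e′} c f → e ≡ e′ → powBin e c f ≗ powBin e′ c f
powBin-exp c f refl m = refl

prodBin-cong : ∀ e K {f g} → f ≗ g → prodBin e K f ≗ prodBin e K g
prodBin-cong e zero    f≗g = f≗g
prodBin-cong e (suc K) f≗g = powBin-cong (e (suc K)) (suc K) (prodBin-cong e K f≗g)

prodBin-exp : ∀ e e′ K f → (∀ a → e (suc a) ≡ e′ (suc a)) → prodBin e K f ≗ prodBin e′ K f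
prodBin-exp e e′ zero    f e≡e′ m = refl
prodBin-exp e e′ (suc K) f e≡e′ m =
  trans (powBin-exp (suc K) _ (e≡e′ K) m) (powBin-cong (e′ (suc K)) (suc K) (prodBin-exp e e′ K f e≡e′) m)

prodBin-powBin : ∀ e K x c f → prodBin e K (powBin x c f) ≗ powBin x c (prodBin e K f)
prodBin-powBin e zero    x c f m = refl
prodBin-powBin e (suc K) x c f m =
  trans (powBin-cong (e (suc K)) (suc K) (prodBin-powBin e K x c f) m)
        (powBin-comm (e (suc K)) x (suc K) c (prodBin e K f) m)

prodBin-merge : ∀ e e′ K f → prodBin e K (prodBin e′ K f) ≗ prodBin (e ⊞ e′) K f
prodBin-merge e e′ zero    f m = refl
prodBin-merge e e′ (suc K) f m =
  trans (powBin-cong (e (suc K)) (suc K) (prodBin-powBin e K (e′ (suc K)) (suc K) (prodBin e′ K f)) m)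
  (trans (powBin-cong (e (suc K)) (suc K) (powBin-cong (e′ (suc K)) (suc K) (prodBin-merge e e′ K f)) m)
         (powBin-+ (e (suc K)) (e′ (suc K)) (suc K) (prodBin (e ⊞ e′) K f) m))

sub-negative : ∀ {n} c → n < c → + n - + c ≡ -[1+ c ∸ suc n ]
sub-negative {n} (suc c) (s≤s n≤c) = begin
  + n - + suc c     ≡⟨ ℤP.m-n≡m⊖n n (suc c) ⟩
  n ⊖ suc c         ≡⟨ ℤP.⊖-< (s≤s n≤c) ⟩
  - + (suc c ∸ n)   ≡⟨ cong (-_ ∘ +_) (ℕP.+-∸-assoc 1 n≤c) ⟩
  -[1+ c ∸ n ]      ∎
  where open ≡-Reasoning

sub-nonneg : ∀ {n} c → c ≤ n → + n - + c ≡ + (n ∸ c)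
sub-nonneg {n} c c≤n = trans (ℤP.m-n≡m⊖n n c) (ℤP.⊖-≥ c≤n)

mulBin-power : ∀ c {f} → PowerSeries f → PowerSeries (mulBin c f)
mulBin-power zero    pf = powerSeries λ d → cong₂ _xor_ (below pf d) (below pf d)
mulBin-power (suc c) pf = powerSeries λ d → cong₂ _xor_ (below pf d) (below pf (suc (d + c)))

powBin-power : ∀ e c {f} → PowerSeries f → PowerSeries (powBin e c f)
powBin-power zero    c pf = pf
powBin-power (suc e) c pf = mulBin-power c (powBin-power e c pf)

prodBin-power : ∀ e K {f} → PowerSeries f → PowerSeries (prodBin e K f)
prodBin-power e zero    pf = pf
prodBin-power e (suc K) pf = powBin-power (e (suc K)) (suc K) (prodBin-power e K pf)

one-power : PowerSeries one
one-power = powerSeries λ d → refl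

agree-trans : ∀ {B f g h} → AgreeUpTo B f g → AgreeUpTo B g h → AgreeUpTo B f h
agree-trans f≈g g≈h m m≤B = trans (f≈g m m≤B) (g≈h m m≤B)

mulBin-agree : ∀ c B {f g} → AgreeUpTo B f g → AgreeUpTo B (mulBin c f) (mulBin c g)
mulBin-agree c B f≈g m m≤B =
  cong₂ _xor_ (f≈g m m≤B) (f≈g (m - + c) (ℤP.≤-trans (ℤP.i-j≤i m (+ c)) m≤B))

powBin-agree : ∀ e c B {f g} → AgreeUpTo B f g → AgreeUpTo B (powBin e c f) (powBin e c g)
powBin-agree zero    c B f≈g = f≈g
powBin-agree (suc e) c B f≈g = mulBin-agree c B (powBin-agree e c B f≈g)

prodBin-agree : ∀ e K B {f g} → AgreeUpTo B f g → AgreeUpTo B (prodBin e K f) (prodBin e K g)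
prodBin-agree e zero    B f≈g = f≈g
prodBin-agree e (suc K) B f≈g = powBin-agree (e (suc K)) (suc K) B (prodBin-agree e K B f≈g)

mulBin-high : ∀ c {f} → PowerSeries f → ∀ L → L < c → AgreeUpTo (+ L) (mulBin c f) f
mulBin-high c {f} pf L L<c -[1+ d ] _ = trans (below (mulBin-power c pf) d) (sym (below pf d))
mulBin-high c {f} pf L L<c (+ n) n≤L =
  trans (cong (f (+ n) xor_) (trans (cong f (sub-negative c (ℕP.<-≤-trans (s≤s (ℤP.drop‿+≤+ n≤L)) L<c)))
                                    (below pf _)))
        (xor-identityʳ (f (+ n)))

powBin-high : ∀ e c {f} → PowerSeries f → ∀ L → L < c → AgreeUpTo (+ L) (powBin e c f) f
powBin-high zero    c pf L L<c m _ = refl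
powBin-high (suc e) c pf L L<c =
  agree-trans (mulBin-high c (powBin-power e c pf) L L<c) (powBin-high e c pf L L<c)

prodBin-truncate : ∀ e d L {f} → PowerSeries f → AgreeUpTo (+ L) (prodBin e (L + d) f) (prodBin e L f)
prodBin-truncate e zero    L pf rewrite ℕP.+-identityʳ L = λ m _ → refl
prodBin-truncate e (suc d) L pf rewrite ℕP.+-suc L d =
  agree-trans (powBin-high (e (suc (L + d))) (suc (L + d)) (prodBin-power e (L + d) pf) L (s≤s (ℕP.m≤m+n L d)))
              (prodBin-truncate e d L pf)

mulBin-injective : ∀ c B {f g} → 1 ≤ c → PowerSeries f → PowerSeries g →
                   AgreeUpTo B (mulBin c f) (mulBin c g) → AgreeUpTo B f g
mulBin-injective c B {f} {g} c≥1 pf pg h -[1+ d ] _ = trans (below pf d) (sym (below pg d))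
mulBin-injective c B {f} {g} c≥1 pf pg h (+ n) = <-rec P step n
  where
  P : ℕ → Set
  P n = + n ℤ.≤ B → f (+ n) ≡ g (+ n)
  recover : ∀ k m → k m ≡ mulBin c k m xor k (m - + c)
  recover k m = sym (trans (xor-assoc (k m) _ _) (trans (cong (k m xor_) (xor-same (k (m - + c)))) (xor-identityʳ (k m))))
  step : ∀ n → (∀ {m} → m < n → P m) → P n
  step n ih n≤B = begin
    f (+ n)                               ≡⟨ recover f (+ n) ⟩
    mulBin c f (+ n) xor f (+ n - + c)    ≡⟨ cong₂ _xor_ (h (+ n) n≤B) earlier ⟩
    mulBin c g (+ n) xor g (+ n - + c)    ≡⟨ sym (recover g (+ n)) ⟩
    g (+ n)                               ∎
    where
    open ≡-Reasoning
    earlier : f (+ n - + c) ≡ g (+ n - + c)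
    earlier with c ℕP.≤? n
    ... | yes c≤n rewrite sub-nonneg c c≤n =
      ih (ℕP.∸-monoʳ-< c≥1 c≤n) (ℤP.≤-trans (ℤ.+≤+ (ℕP.m∸n≤m n c)) n≤B)
    ... | no c≰n rewrite sub-negative c (ℕP.≰⇒> c≰n) = trans (below pf _) (sym (below pg _))

powBin-injective : ∀ e c B {f g} → 1 ≤ c → PowerSeries f → PowerSeries g →
                   AgreeUpTo B (powBin e c f) (powBin e c g) → AgreeUpTo B f g
powBin-injective zero    c B c≥1 pf pg h = h
powBin-injective (suc e) c B c≥1 pf pg h =
  powBin-injective e c B c≥1 pf pg
    (mulBin-injective c B c≥1 (powBin-power e c pf) (powBin-power e c pg) h)

prodBin-injective : ∀ e K B {f g} → PowerSeries f → PowerSeries g →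
                    AgreeUpTo B (prodBin e K f) (prodBin e K g) → AgreeUpTo B f g
prodBin-injective e zero    B pf pg h = h
prodBin-injective e (suc K) B pf pg h =
  prodBin-injective e K B pf pg
    (powBin-injective (e (suc K)) (suc K) B (s≤s z≤n) (prodBin-power e K pf) (prodBin-power e K pg) h)

-- Frobenius and descent

dilate : {A : Set} → A → (ℕ → A) → ℕ → A
dilate z h zero          = h zero
dilate z h (suc zero)    = z
dilate z h (suc (suc n)) = dilate z (h ∘ suc) n

dilate-even : ∀ {A : Set} (z : A) h b → dilate z h (b + b) ≡ h b
dilate-even z h zero    = refl
dilate-even z h (suc b) rewrite ℕP.+-suc b b = dilate-even z (h ∘ suc) b

dilate-odd : ∀ {A : Set} (z : A) h b → dilate z h (suc (b + b)) ≡ z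
dilate-odd z h zero    = refl
dilate-odd z h (suc b) rewrite ℕP.+-suc b b = dilate-odd z (h ∘ suc) b

parityℕ-elim : (P : ℕ → Set) → (∀ b → P (b + b)) → (∀ b → P (suc (b + b))) → ∀ n → P n
parityℕ-elim P even odd zero          = even zero
parityℕ-elim P even odd (suc zero)    = odd zero
parityℕ-elim P even odd (suc (suc n)) =
  parityℕ-elim (P ∘ suc ∘ suc) (λ b → subst P (shift b) (even (suc b)))
                               (λ b → subst P (cong suc (shift b)) (odd (suc b))) n
  where
  shift : ∀ b → suc b + suc b ≡ suc (suc (b + b))
  shift b = cong suc (ℕP.+-suc b b)

parity-elim : (P : ℤ → Set) → (∀ x → P (x ℤ.+ x)) → (∀ x → P (ℤ.suc (x ℤ.+ x))) → ∀ m → P m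
parity-elim P even odd (+ n)     = parityℕ-elim (P ∘ +_) (even ∘ +_) (odd ∘ +_) n
parity-elim P even odd -[1+ n ] = parityℕ-elim (P ∘ -[1+_]) (odd ∘ -[1+_]) (even ∘ -[1+_]) n

-- frob g = g(q²).
frob : Series → Series
frob g (+ n)     = dilate false (g ∘ +_) n
frob g -[1+ n ] = false

frob-even : ∀ {g} → PowerSeries g → ∀ x → frob g (x ℤ.+ x) ≡ g x
frob-even pg (+ b)     = dilate-even false _ b
frob-even pg -[1+ b ] = sym (below pg b)

frob-odd : ∀ g x → frob g (ℤ.suc (x ℤ.+ x)) ≡ false
frob-odd g (+ b)     = dilate-odd false _ b
frob-odd g -[1+ b ] = refl

one-even : ∀ x → one (x ℤ.+ x) ≡ one x
one-even (+ zero)     = refl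
one-even (+ suc b)    = refl
one-even -[1+ b ]     = refl

one-odd : ∀ x → one (ℤ.suc (x ℤ.+ x)) ≡ false
one-odd (+ b)     = refl
one-odd -[1+ b ] = refl

frob-one : frob one ≗ one
frob-one = parity-elim _ (λ x → trans (frob-even one-power x) (sym (one-even x)))
                         (λ x → trans (frob-odd one x) (sym (one-odd x)))

frob-mulBin : ∀ a {g} → PowerSeries g → frob (mulBin a g) ≗ mulBin (a + a) (frob g)
frob-mulBin a {g} pg = parity-elim _ even odd
  where
  halve : ∀ x y → (x ℤ.+ x) - (y ℤ.+ y) ≡ (x - y) ℤ.+ (x - y)
  halve = solve-∀
  halve-odd : ∀ x y → + 1 ℤ.+ (x ℤ.+ x) - (y ℤ.+ y) ≡ + 1 ℤ.+ ((x - y) ℤ.+ (x - y))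
  halve-odd = solve-∀
  even : ∀ x → frob (mulBin a g) (x ℤ.+ x) ≡ mulBin (a + a) (frob g) (x ℤ.+ x)
  even x = begin
    frob (mulBin a g) (x ℤ.+ x)                      ≡⟨ frob-even (mulBin-power a pg) x ⟩
    g x xor g (x - + a)                              ≡⟨ sym (cong₂ _xor_ (frob-even pg x) (frob-even pg (x - + a))) ⟩
    frob g (x ℤ.+ x) xor frob g ((x - + a) ℤ.+ (x - + a)) ≡⟨ cong (λ y → frob g (x ℤ.+ x) xor frob g y) (sym (halve x (+ a))) ⟩
    mulBin (a + a) (frob g) (x ℤ.+ x)                ∎
    where open ≡-Reasoning
  odd : ∀ x → frob (mulBin a g) (ℤ.suc (x ℤ.+ x)) ≡ mulBin (a + a) (frob g) (ℤ.suc (x ℤ.+ x))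
  odd x = sym (trans (cong₂ _xor_ (frob-odd g x) (trans (cong (frob g) (halve-odd x (+ a))) (frob-odd g (x - + a))))
                     (sym (frob-odd (mulBin a g) x)))

powBin-frob : ∀ e a {c g} → c ≡ a + a → PowerSeries g → powBin e c (frob g) ≗ frob (powBin e a g)
powBin-frob zero    a refl pg m = refl
powBin-frob (suc e) a refl pg m =
  trans (mulBin-cong (a + a) (powBin-frob e a refl pg) m) (sym (frob-mulBin a (powBin-power e a pg) m))

prodBin-frob : ∀ μ K {g} → PowerSeries g → prodBin (dilate 0 μ) (K + K) (frob g) ≗ frob (prodBin μ K g)
prodBin-frob μ zero    pg m = refl
prodBin-frob μ (suc K) pg m rewrite ℕP.+-suc K K
                                  | dilate-even 0 (μ ∘ suc) K | dilate-odd 0 μ K =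
  trans (powBin-cong (μ (suc K)) _ (prodBin-frob μ K pg) m)
        (powBin-frob (μ (suc K)) (suc K) (cong suc (sym (ℕP.+-suc K K))) (prodBin-power μ K pg) m)

prodBin-double : ∀ e K f → prodBin (e ⊞ e) K f ≗ prodBin (dilate 0 e) (K + K) f
prodBin-double e zero    f m = refl
prodBin-double e (suc K) f m rewrite ℕP.+-suc K K
                               | dilate-even 0 (e ∘ suc) K | dilate-odd 0 e K =
  trans (powBin-double (e (suc K)) (suc K) _ (cong suc (sym (ℕP.+-suc K K))) m)
        (powBin-cong (e (suc K)) (suc (suc (K + K))) (prodBin-double e K f) m)

frob-vanishes : ∀ {g} n → (∀ {m} → 0 < m → m < n → g (+ m) ≡ false) → 0 < n → frob g (+ n) ≡ false
frob-vanishes {g} = parityℕ-elim (λ n → (∀ {m} → 0 < m → m < n → g (+ m) ≡ false) → 0 < n → frob g (+ n) ≡ false)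
  (λ b low 0<b+b → trans (dilate-even false _ b) (low (positive b 0<b+b) (ℕP.m<m+n b (positive b 0<b+b))))
  (λ b low _ → dilate-odd false _ b)
  where
  positive : ∀ b → 0 < b + b → 0 < b
  positive (suc b) _ = s≤s z≤n

-- The hypotheses make F = ∏ (1 + q^a)^(μ a) agree with F(q²) in low degrees, which forces F ≡ 1 there.
descent : ∀ μ μ₁ μ₂ K →
          (∀ a → μ (suc a) ≡ μ₁ (suc a) + (μ₂ (suc a) + μ₂ (suc a))) →
          (∀ c → μ₁ (suc c) + dilate 0 μ₂ (suc c) ≡ dilate 0 μ (suc c)) →
          AgreeUpTo (+ K) (prodBin μ K one) one
descent μ μ₁ μ₂ K split recombine = G≈one
  where
  G : Series
  G = prodBin μ K one
  G≈frobG : AgreeUpTo (+ K) G (frob G)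
  G≈frobG m m≤K = begin
    G m                                           ≡⟨ prodBin-exp μ (μ₁ ⊞ (μ₂ ⊞ μ₂)) K one split m ⟩
    prodBin (μ₁ ⊞ (μ₂ ⊞ μ₂)) K one m              ≡⟨ sym (prodBin-merge μ₁ (μ₂ ⊞ μ₂) K one m) ⟩
    prodBin μ₁ K (prodBin (μ₂ ⊞ μ₂) K one) m      ≡⟨ prodBin-cong μ₁ K (prodBin-double μ₂ K one) m ⟩
    prodBin μ₁ K H m                              ≡⟨ sym (prodBin-truncate μ₁ K K H-power m m≤K) ⟩
    prodBin μ₁ (K + K) H m                        ≡⟨ prodBin-merge μ₁ (dilate 0 μ₂) (K + K) one m ⟩
    prodBin (μ₁ ⊞ dilate 0 μ₂) (K + K) one m      ≡⟨ prodBin-exp _ (dilate 0 μ) (K + K) one recombine m ⟩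
    prodBin (dilate 0 μ) (K + K) one m            ≡⟨ prodBin-cong (dilate 0 μ) (K + K) (sym ∘ frob-one) m ⟩
    prodBin (dilate 0 μ) (K + K) (frob one) m     ≡⟨ prodBin-frob μ K one-power m ⟩
    frob G m                                      ∎
    where
    open ≡-Reasoning
    H = prodBin (dilate 0 μ₂) (K + K) one
    H-power = prodBin-power (dilate 0 μ₂) (K + K) one-power
  P : ℕ → Set
  P n = n ≤ K → G (+ n) ≡ one (+ n)
  step : ∀ n → (∀ {m} → m < n → P m) → P n
  step zero    ih _    = prodBin-truncate μ K 0 one-power (+ 0) ℤP.≤-refl
  step (suc n) ih n<K = trans (G≈frobG (+ suc n) (ℤ.+≤+ n<K)) (frob-vanishes {G} (suc n) low (s≤s z≤n))
    where
    low : ∀ {m} → 0 < m → m < suc n → G (+ m) ≡ false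
    low {suc m} _ m<n = ih m<n (ℕP.≤-trans (ℕP.<⇒≤ m<n) n<K)
  G≈one : AgreeUpTo (+ K) G one
  G≈one -[1+ d ] _   = below (prodBin-power μ K one-power) d
  G≈one (+ n)    n≤K = <-rec P step n (ℤP.drop‿+≤+ n≤K)

-- The finite Jacobi triple product mod 2

Series₂ : Set
Series₂ = ℤ → ℤ → Bool

infix 4 _≗₂_
_≗₂_ : Series₂ → Series₂ → Set
f ≗₂ g = ∀ j n → f j n ≡ g j n

≗₂-trans : ∀ {f g h} → f ≗₂ g → g ≗₂ h → f ≗₂ h
≗₂-trans f≗g g≗h j n = trans (f≗g j n) (g≗h j n)

≗₂-sym : ∀ {f g} → f ≗₂ g → g ≗₂ f
≗₂-sym f≗g j n = sym (f≗g j n)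

one₂ : Series₂
one₂ (+ zero) (+ zero) = true
one₂ _        _        = false

-- In F = Σ F j n z^j q^n: mulBin₂ s b F = (1 + z^s q^b) F, shift₂ s b F = z^s q^b F
-- and twist F (z , q) = F (z q^6 , q).
mulBin₂ : ℤ → ℤ → Series₂ → Series₂
mulBin₂ s b f j n = f j n xor f (j - s) (n - b)

shift₂ : ℤ → ℤ → Series₂ → Series₂
shift₂ s b f j n = f (j - s) (n - b)

twist : Series₂ → Series₂
twist f j n = f j (n - + 6 ℤ.* j)

mulBin₂-cong : ∀ s b {f g} → f ≗₂ g → mulBin₂ s b f ≗₂ mulBin₂ s b g
mulBin₂-cong s b f≗g j n = cong₂ _xor_ (f≗g j n) (f≗g (j - s) (n - b))

mulBin₂-degree : ∀ s {b b′} f → b ≡ b′ → mulBin₂ s b f ≗₂ mulBin₂ s b′ f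
mulBin₂-degree s f refl j n = refl

mulBin₂-comm : ∀ s b t c f → mulBin₂ s b (mulBin₂ t c f) ≗₂ mulBin₂ t c (mulBin₂ s b f)
mulBin₂-comm s b t c f j n =
  trans (xor-interchange (f j n) (f (j - t) (n - c)) (f (j - s) (n - b)) (f ((j - s) - t) ((n - b) - c)))
        (cong₂ (λ x y → (f j n xor f (j - s) (n - b)) xor (f (j - t) (n - c) xor f x y))
               (sub-swap j s t) (sub-swap n b c))
  where
  sub-swap : ∀ m x y → (m - x) - y ≡ (m - y) - x
  sub-swap = solve-∀

shift₂-cong : ∀ s b {f g} → f ≗₂ g → shift₂ s b f ≗₂ shift₂ s b g
shift₂-cong s b f≗g j n = f≗g (j - s) (n - b)

shift₂-mulBin₂ : ∀ s b t c f → shift₂ s b (mulBin₂ t c f) ≗₂ mulBin₂ t c (shift₂ s b f)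
shift₂-mulBin₂ s b t c f j n = cong₂ (λ x y → f (j - s) (n - b) xor f x y) (sub-swap j s t) (sub-swap n b c)
  where
  sub-swap : ∀ m x y → (m - x) - y ≡ (m - y) - x
  sub-swap = solve-∀

mulBin₂-reflect : ∀ s b f → mulBin₂ (- s) (- b) f ≗₂ shift₂ (- s) (- b) (mulBin₂ s b f)
mulBin₂-reflect s b f j n =
  trans (xor-comm (f j n) _) (cong₂ (λ x y → f (j - - s) (n - - b) xor f x y) (sub-neg j s) (sub-neg n b))
  where
  sub-neg : ∀ m x → m ≡ (m - - x) - x
  sub-neg = solve-∀

twist-mulBin₂ : ∀ s b f → twist (mulBin₂ s b f) ≗₂ mulBin₂ s (b ℤ.+ + 6 ℤ.* s) (twist f)
twist-mulBin₂ s b f j n = cong (λ y → f j (n - + 6 ℤ.* j) xor f (j - s) y) (regroup n j s b)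
  where
  regroup : ∀ n j s b → n - + 6 ℤ.* j - b ≡ n - (b ℤ.+ + 6 ℤ.* s) - + 6 ℤ.* (j - s)
  regroup = solve-∀

twist-one₂ : twist one₂ ≗₂ one₂
twist-one₂ (+ zero)  n = cong (one₂ (+ 0)) (ℤP.+-identityʳ n)
twist-one₂ (+ suc j) n = refl
twist-one₂ -[1+ j ]  n = refl

deg₃ : ℕ → ℤ
deg₃ k = + 6 ℤ.* + k ℤ.+ + 3

-- triple K = ∏_{k < K} (1 + z q^(6k+3)) (1 + z⁻¹ q^(6k+3)); triple′ K is its twist (twist-triple).
triple : ℕ → Series₂
triple zero    = one₂
triple (suc k) = mulBin₂ (+ 1) (deg₃ k) (mulBin₂ (- + 1) (deg₃ k) (triple k))

triple′ : ℕ → Series₂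
triple′ zero    = one₂
triple′ (suc k) = mulBin₂ (+ 1) (deg₃ k ℤ.+ + 6) (mulBin₂ (- + 1) (deg₃ k - + 6) (triple′ k))

twist-triple : ∀ K → twist (triple K) ≗₂ triple′ K
twist-triple zero    = twist-one₂
twist-triple (suc k) =
  ≗₂-trans (twist-mulBin₂ (+ 1) (deg₃ k) (mulBin₂ (- + 1) (deg₃ k) (triple k)))
  (≗₂-trans (mulBin₂-cong (+ 1) b⁺ (twist-mulBin₂ (- + 1) (deg₃ k) (triple k)))
  (≗₂-trans (mulBin₂-cong (+ 1) b⁺ (mulBin₂-cong (- + 1) b⁻ (twist-triple k)))
  (≗₂-trans (mulBin₂-degree (+ 1) (mulBin₂ (- + 1) b⁻ (triple′ k)) (up (+ k)))
            (mulBin₂-cong (+ 1) (deg₃ k ℤ.+ + 6) (mulBin₂-degree (- + 1) (triple′ k) (down (+ k)))))))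
  where
  b⁺ = deg₃ k ℤ.+ + 6 ℤ.* + 1
  b⁻ = deg₃ k ℤ.+ + 6 ℤ.* - + 1
  up : ∀ x → (+ 6 ℤ.* x ℤ.+ + 3) ℤ.+ + 6 ℤ.* + 1 ≡ (+ 6 ℤ.* x ℤ.+ + 3) ℤ.+ + 6
  up = solve-∀
  down : ∀ x → (+ 6 ℤ.* x ℤ.+ + 3) ℤ.+ + 6 ℤ.* - + 1 ≡ (+ 6 ℤ.* x ℤ.+ + 3) - + 6
  down = solve-∀

triple-functional : ∀ K → mulBin₂ (- + 1) (deg₃ K - + 6) (triple′ K)
                          ≗₂ shift₂ (- + 1) (- + 3) (mulBin₂ (+ 1) (deg₃ K) (triple K))
triple-functional zero    = mulBin₂-reflect (+ 1) (+ 3) one₂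
triple-functional (suc k) =
  ≗₂-trans (mulBin₂-degree (- + 1) (triple′ (suc k)) (next (+ k)))
  (≗₂-trans (mulBin₂-comm (- + 1) (deg₃ k) (+ 1) (deg₃ k ℤ.+ + 6) F′)
  (≗₂-trans (mulBin₂-cong (+ 1) (deg₃ k ℤ.+ + 6) (mulBin₂-cong (- + 1) (deg₃ k) (triple-functional k)))
  (≗₂-trans (mulBin₂-cong (+ 1) (deg₃ k ℤ.+ + 6) (≗₂-sym (shift₂-mulBin₂ (- + 1) (- + 3) (- + 1) (deg₃ k) F)))
  (≗₂-trans (≗₂-sym (shift₂-mulBin₂ (- + 1) (- + 3) (+ 1) (deg₃ k ℤ.+ + 6) (mulBin₂ (- + 1) (deg₃ k) F)))
            (shift₂-cong (- + 1) (- + 3)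
              (≗₂-trans (mulBin₂-degree (+ 1) (mulBin₂ (- + 1) (deg₃ k) F) (next′ (+ k)))
                        (mulBin₂-cong (+ 1) (deg₃ (suc k)) (mulBin₂-comm (- + 1) (deg₃ k) (+ 1) (deg₃ k) (triple k)))))))))
  where
  F  = mulBin₂ (+ 1) (deg₃ k) (triple k)
  F′ = mulBin₂ (- + 1) (deg₃ k - + 6) (triple′ k)
  next : ∀ x → (+ 6 ℤ.* (+ 1 ℤ.+ x) ℤ.+ + 3) - + 6 ≡ + 6 ℤ.* x ℤ.+ + 3
  next = solve-∀
  next′ : ∀ x → (+ 6 ℤ.* x ℤ.+ + 3) ℤ.+ + 6 ≡ + 6 ℤ.* (+ 1 ℤ.+ x) ℤ.+ + 3
  next′ = solve-∀

record PowerSeries₂ (f : Series₂) : Set where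
  constructor powerSeries₂
  field below₂ : ∀ j {n} → n ℤ.< 0ℤ → f j n ≡ false
open PowerSeries₂

one₂-power : PowerSeries₂ one₂
one₂-power = powerSeries₂ vanish
  where
  vanish : ∀ j {n} → n ℤ.< 0ℤ → one₂ j n ≡ false
  vanish (+ zero)  { -[1+ n ]} _ = refl
  vanish (+ suc j) { -[1+ n ]} _ = refl
  vanish -[1+ j ]  { -[1+ n ]} _ = refl
  vanish j         {+ n}      (ℤ.+<+ ())

mulBin₂-power : ∀ s b {f} → 0ℤ ℤ.≤ b → PowerSeries₂ f → PowerSeries₂ (mulBin₂ s b f)
mulBin₂-power s b 0≤b pf = powerSeries₂ λ j n<0 →
  cong₂ _xor_ (below₂ pf j n<0)
              (below₂ pf (j - s) (ℤP.≤-<-trans (ℤP.i-j≤i _ b {{ℤ.nonNegative 0≤b}}) n<0))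

deg₃-nonneg : ∀ k → 0ℤ ℤ.≤ deg₃ k
deg₃-nonneg k = subst (0ℤ ℤ.≤_) (cong (ℤ._+ + 3) (ℤP.pos-* 6 k)) (ℤ.+≤+ z≤n)

triple-power : ∀ K → PowerSeries₂ (triple K)
triple-power zero    = one₂-power
triple-power (suc k) = mulBin₂-power (+ 1) (deg₃ k) (deg₃-nonneg k)
                         (mulBin₂-power (- + 1) (deg₃ k) (deg₃-nonneg k) (triple-power k))

-- The coefficient of z^j q^(m + 6j) in the functional equation; its two terms of negative degree vanish.
triple-step : ∀ K j m → m ℤ.≤ + 6 ℤ.* + K → m ℤ.+ (+ 6 ℤ.* j ℤ.+ + 3) ℤ.≤ + 6 ℤ.* + K →
              triple K j m ≡ triple K (+ 1 ℤ.+ j) (m ℤ.+ (+ 6 ℤ.* j ℤ.+ + 3))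
triple-step K j m m≤ m′≤ = begin
  triple K j m                                                     ≡⟨ sym (xor-identityʳ _) ⟩
  triple K j m xor false
    ≡⟨ cong₂ _xor_ (cong (triple K j) (e₁ m j))
                   (sym (trans (cong (triple K (j - - + 1)) (e₂ m j (+ K))) (vanish (j - - + 1) m m≤))) ⟩
  twist (triple K) j N xor twist (triple K) (j - - + 1) (N - (deg₃ K - + 6))
    ≡⟨ cong₂ _xor_ (twist-triple K j N) (twist-triple K (j - - + 1) (N - (deg₃ K - + 6))) ⟩
  mulBin₂ (- + 1) (deg₃ K - + 6) (triple′ K) j N                  ≡⟨ triple-functional K j N ⟩
  shift₂ (- + 1) (- + 3) (mulBin₂ (+ 1) (deg₃ K) (triple K)) j N
    ≡⟨ cong₂ _xor_ (cong₂ (triple K) (e₃ j) (e₄ m j))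
                   (trans (cong₂ (triple K) (e₅ j) (e₆ m j (deg₃ K))) (vanish j m′ m′≤)) ⟩
  triple K (+ 1 ℤ.+ j) m′ xor false                                ≡⟨ xor-identityʳ _ ⟩
  triple K (+ 1 ℤ.+ j) m′                                          ∎
  where
  open ≡-Reasoning
  N  = m ℤ.+ + 6 ℤ.* j
  m′ = m ℤ.+ (+ 6 ℤ.* j ℤ.+ + 3)
  gap : ∀ y → + 6 ℤ.* y - (+ 6 ℤ.* y ℤ.+ + 3) ≡ - + 3
  gap = solve-∀
  vanish : ∀ i x → x ℤ.≤ + 6 ℤ.* + K → triple K i (x - deg₃ K) ≡ false
  vanish i x x≤ = below₂ (triple-power K) i
    (ℤP.≤-<-trans (ℤP.+-monoˡ-≤ (- deg₃ K) x≤) (subst (ℤ._< 0ℤ) (sym (gap (+ K))) ℤ.-<+))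
  e₁ : ∀ m j → m ≡ m ℤ.+ + 6 ℤ.* j - + 6 ℤ.* j
  e₁ = solve-∀
  e₂ : ∀ m j k → m ℤ.+ + 6 ℤ.* j - ((+ 6 ℤ.* k ℤ.+ + 3) - + 6) - + 6 ℤ.* (j - - + 1) ≡ m - (+ 6 ℤ.* k ℤ.+ + 3)
  e₂ = solve-∀
  e₃ : ∀ j → j - - + 1 ≡ + 1 ℤ.+ j
  e₃ = solve-∀
  e₄ : ∀ m j → m ℤ.+ + 6 ℤ.* j - - + 3 ≡ m ℤ.+ (+ 6 ℤ.* j ℤ.+ + 3)
  e₄ = solve-∀
  e₅ : ∀ j → j - - + 1 - + 1 ≡ j
  e₅ = solve-∀
  e₆ : ∀ m j b → m ℤ.+ + 6 ℤ.* j - - + 3 - b ≡ m ℤ.+ (+ 6 ℤ.* j ℤ.+ + 3) - b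
  e₆ = solve-∀

sq₃ : ℤ → ℤ
sq₃ j = + 3 ℤ.* (j ℤ.* j)

drop-step : ∀ {x B} i → x ℤ.+ (+ 6 ℤ.* + i ℤ.+ + 3) ℤ.≤ B → x ℤ.≤ B
drop-step {x} i h =
  ℤP.≤-trans (ℤP.i≤i+j x (+ (6 * i + 3)))
             (subst (λ y → x ℤ.+ y ℤ.≤ _) (cong (ℤ._+ + 3) (sym (ℤP.pos-* 6 i))) h)

triple-coeff⁺ : ∀ K i m → m ℤ.+ sq₃ (+ i) ℤ.≤ + 6 ℤ.* + K →
                triple K (+ i) (m ℤ.+ sq₃ (+ i)) ≡ triple K 0ℤ m
triple-coeff⁺ K zero    m h = cong (triple K 0ℤ) (ℤP.+-identityʳ m)
triple-coeff⁺ K (suc i) m h = begin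
  triple K (+ suc i) (m ℤ.+ sq₃ (+ suc i))          ≡⟨ cong (triple K (+ suc i)) (grow (+ i) m) ⟩
  triple K (+ 1 ℤ.+ + i) (X ℤ.+ (+ 6 ℤ.* + i ℤ.+ + 3)) ≡⟨ sym (triple-step K (+ i) X (drop-step i h′) h′) ⟩
  triple K (+ i) X                                  ≡⟨ triple-coeff⁺ K i m (drop-step i h′) ⟩
  triple K 0ℤ m                                     ∎
  where
  open ≡-Reasoning
  X = m ℤ.+ sq₃ (+ i)
  grow : ∀ x m → m ℤ.+ + 3 ℤ.* ((+ 1 ℤ.+ x) ℤ.* (+ 1 ℤ.+ x)) ≡ (m ℤ.+ + 3 ℤ.* (x ℤ.* x)) ℤ.+ (+ 6 ℤ.* x ℤ.+ + 3)
  grow = solve-∀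
  h′ : X ℤ.+ (+ 6 ℤ.* + i ℤ.+ + 3) ℤ.≤ + 6 ℤ.* + K
  h′ = subst (ℤ._≤ _) (grow (+ i) m) h

triple-coeff⁻ : ∀ K i m → m ℤ.+ sq₃ (- + i) ℤ.≤ + 6 ℤ.* + K →
                triple K (- + i) (m ℤ.+ sq₃ (- + i)) ≡ triple K 0ℤ m
triple-coeff⁻ K zero    m h = cong (triple K 0ℤ) (ℤP.+-identityʳ m)
triple-coeff⁻ K (suc i) m h = begin
  triple K (- + suc i) X′
    ≡⟨ triple-step K (- + suc i) X′ h (subst (ℤ._≤ _) (sym (shrink (+ i) m)) X≤) ⟩
  triple K (+ 1 ℤ.+ - + suc i) (X′ ℤ.+ (+ 6 ℤ.* - + suc i ℤ.+ + 3))
                                                       ≡⟨ cong₂ (triple K) (up (+ i)) (shrink (+ i) m) ⟩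
  triple K (- + i) X                                   ≡⟨ triple-coeff⁻ K i m X≤ ⟩
  triple K 0ℤ m                                        ∎
  where
  open ≡-Reasoning
  X  = m ℤ.+ sq₃ (- + i)
  X′ = m ℤ.+ sq₃ (- + suc i)
  up : ∀ x → + 1 ℤ.+ - (+ 1 ℤ.+ x) ≡ - x
  up = solve-∀
  shrink : ∀ x m → (m ℤ.+ + 3 ℤ.* (- (+ 1 ℤ.+ x) ℤ.* - (+ 1 ℤ.+ x))) ℤ.+ (+ 6 ℤ.* - (+ 1 ℤ.+ x) ℤ.+ + 3)
                   ≡ m ℤ.+ + 3 ℤ.* (- x ℤ.* - x)
  shrink = solve-∀
  grow : ∀ x m → m ℤ.+ + 3 ℤ.* (- (+ 1 ℤ.+ x) ℤ.* - (+ 1 ℤ.+ x)) ≡ (m ℤ.+ + 3 ℤ.* (- x ℤ.* - x)) ℤ.+ (+ 6 ℤ.* x ℤ.+ + 3)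
  grow = solve-∀
  X≤ : X ℤ.≤ + 6 ℤ.* + K
  X≤ = drop-step i (subst (ℤ._≤ _) (grow (+ i) m) h)

triple-row : ∀ K j m → m ℤ.+ sq₃ j ℤ.≤ + 6 ℤ.* + K → triple K j (m ℤ.+ sq₃ j) ≡ triple K 0ℤ m
triple-row K (+ i)     = triple-coeff⁺ K i
triple-row K -[1+ i ] = triple-coeff⁻ K (suc i)

triple-coeff : ∀ K j n → n ℤ.≤ + 6 ℤ.* + K → triple K j n ≡ triple K 0ℤ (n - sq₃ j)
triple-coeff K j n n≤ =
  trans (cong (triple K j) (split j n)) (triple-row K j (n - sq₃ j) (subst (ℤ._≤ _) (split j n) n≤))
  where
  split : ∀ j n → n ≡ (n - + 3 ℤ.* (j ℤ.* j)) ℤ.+ + 3 ℤ.* (j ℤ.* j)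
  split = solve-∀

-- Symmetric sums and specialisation

window : ℤ → ℕ → (ℤ → Bool) → Bool
window lo n g = xorBelow (λ m → g (lo ℤ.+ + m)) n

window-cons : ∀ lo n g → window lo (suc n) g ≡ g lo xor window (+ 1 ℤ.+ lo) n g
window-cons lo n g =
  cong₂ _xor_ (cong g (ℤP.+-identityʳ lo)) (xorBelow-cong n (λ m _ → cong g (regroup lo (+ m))))
  where
  regroup : ∀ lo m → lo ℤ.+ (+ 1 ℤ.+ m) ≡ (+ 1 ℤ.+ lo) ℤ.+ m
  regroup = solve-∀

window-snoc : ∀ lo n g → window lo (suc n) g ≡ window lo n g xor g (lo ℤ.+ + n)
window-snoc lo n g = xorBelow-snoc (λ m → g (lo ℤ.+ + m)) n

window-shift : ∀ lo n s g → window lo n (λ j → g (j - s)) ≡ window (lo - s) n g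
window-shift lo n s g = xorBelow-cong n (λ m _ → cong g (regroup lo (+ m) s))
  where
  regroup : ∀ lo m s → lo ℤ.+ m - s ≡ (lo - s) ℤ.+ m
  regroup = solve-∀

window-slide : ∀ lo n g → g lo ≡ false → g (lo ℤ.+ + suc n) ≡ false →
               window lo (suc n) g ≡ window (+ 1 ℤ.+ lo) (suc n) g
window-slide lo n g first last = begin
  window lo (suc n) g                                      ≡⟨ window-cons lo n g ⟩
  g lo xor window (+ 1 ℤ.+ lo) n g                         ≡⟨ cong (_xor window (+ 1 ℤ.+ lo) n g) first ⟩
  window (+ 1 ℤ.+ lo) n g                                  ≡⟨ sym (xor-identityʳ _) ⟩
  window (+ 1 ℤ.+ lo) n g xor false
    ≡⟨ cong (window (+ 1 ℤ.+ lo) n g xor_) (sym (trans (cong g (regroup lo (+ n))) last)) ⟩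
  window (+ 1 ℤ.+ lo) n g xor g ((+ 1 ℤ.+ lo) ℤ.+ + n)     ≡⟨ sym (window-snoc (+ 1 ℤ.+ lo) n g) ⟩
  window (+ 1 ℤ.+ lo) (suc n) g                            ∎
  where
  open ≡-Reasoning
  regroup : ∀ lo n → (+ 1 ℤ.+ lo) ℤ.+ n ≡ lo ℤ.+ (+ 1 ℤ.+ n)
  regroup = solve-∀

symΣ : ℕ → (ℤ → Bool) → Bool
symΣ zero    g = g 0ℤ
symΣ (suc R) g = symΣ R g xor (g (+ suc R) xor g -[1+ R ])

symΣ-window : ∀ R g → symΣ R g ≡ window (- + R) (suc (R + R)) g
symΣ-window zero    g = sym (xor-identityʳ (g 0ℤ))
symΣ-window (suc R) g = begin
  symΣ R g xor (g (+ suc R) xor g -[1+ R ])                         ≡⟨ sym (xor-assoc (symΣ R g) _ _) ⟩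
  (symΣ R g xor g (+ suc R)) xor g -[1+ R ]                         ≡⟨ xor-comm _ (g -[1+ R ]) ⟩
  g -[1+ R ] xor (symΣ R g xor g (+ suc R))
    ≡⟨ cong (g -[1+ R ] xor_) (cong₂ _xor_ (symΣ-window R g) (cong g (sym (right (+ R))))) ⟩
  g -[1+ R ] xor (window (- + R) (suc (R + R)) g xor g (- + R ℤ.+ + suc (R + R)))
    ≡⟨ cong (g -[1+ R ] xor_) (sym (window-snoc (- + R) (suc (R + R)) g)) ⟩
  g -[1+ R ] xor window (- + R) (suc (suc (R + R))) g
    ≡⟨ cong₂ (λ x n → g -[1+ R ] xor window x n g) (sym (left (+ R))) (cong suc (sym (ℕP.+-suc R R))) ⟩
  g -[1+ R ] xor window (+ 1 ℤ.+ -[1+ R ]) (suc (R + suc R)) g    ≡⟨ sym (window-cons -[1+ R ] (suc (R + suc R)) g) ⟩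
  window -[1+ R ] (suc (suc R + suc R)) g                          ∎
  where
  open ≡-Reasoning
  left : ∀ x → + 1 ℤ.+ - (+ 1 ℤ.+ x) ≡ - x
  left = solve-∀
  right : ∀ x → - x ℤ.+ (+ 1 ℤ.+ (x ℤ.+ x)) ≡ + 1 ℤ.+ x
  right = solve-∀

symΣ-xor : ∀ R g h → symΣ R (λ j → g j xor h j) ≡ symΣ R g xor symΣ R h
symΣ-xor zero    g h = refl
symΣ-xor (suc R) g h =
  trans (cong₂ _xor_ (symΣ-xor R g h) (xor-interchange (g (+ suc R)) (h (+ suc R)) (g -[1+ R ]) (h -[1+ R ])))
        (xor-interchange (symΣ R g) (symΣ R h) _ _)

symΣ-cong : ∀ R {g h} → (∀ j → - + R ℤ.≤ j → g j ≡ h j) → symΣ R g ≡ symΣ R h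
symΣ-cong zero    g≡h = g≡h 0ℤ ℤP.≤-refl
symΣ-cong (suc R) g≡h =
  cong₂ _xor_ (symΣ-cong R (λ j -R≤j → g≡h j (ℤP.≤-trans (step R) -R≤j)))
              (cong₂ _xor_ (g≡h (+ suc R) ℤ.-≤+) (g≡h -[1+ R ] ℤP.≤-refl))
  where
  step : ∀ R → -[1+ R ] ℤ.≤ - + R
  step zero    = ℤ.-≤+
  step (suc R) = ℤ.-≤- (ℕP.n≤1+n R)

symΣ-even : ∀ R g → (∀ i → g (+ suc i) ≡ g -[1+ i ]) → symΣ R g ≡ g 0ℤ
symΣ-even zero    g even = refl
symΣ-even (suc R) g even rewrite even R | xor-same (g -[1+ R ]) =
  trans (xor-identityʳ _) (symΣ-even R g even)

symΣ-shift : ∀ R s h → (s ≡ + 1 ⊎ s ≡ - + 1) → (∀ j → R ≤ ℤ.∣ j ∣ → h j ≡ false) →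
             symΣ R (λ j → h (j - s)) ≡ symΣ R h
symΣ-shift R s h unit outside = begin
  symΣ R (λ j → h (j - s))                  ≡⟨ symΣ-window R _ ⟩
  window (- + R) (suc (R + R)) (λ j → h (j - s)) ≡⟨ window-shift (- + R) (suc (R + R)) s h ⟩
  window (- + R - s) (suc (R + R)) h       ≡⟨ slide unit ⟩
  window (- + R) (suc (R + R)) h           ≡⟨ sym (symΣ-window R h) ⟩
  symΣ R h                                  ∎
  where
  open ≡-Reasoning
  e₁ : ∀ x → - x - + 1 ≡ - (+ 1 ℤ.+ x)
  e₁ = solve-∀
  e₂ : ∀ x → - (+ 1 ℤ.+ x) ℤ.+ (+ 1 ℤ.+ (x ℤ.+ x)) ≡ x
  e₂ = solve-∀
  e₃ : ∀ x → + 1 ℤ.+ (- x - + 1) ≡ - x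
  e₃ = solve-∀
  e₄ : ∀ x → - x ℤ.+ (+ 1 ℤ.+ (x ℤ.+ x)) ≡ + 1 ℤ.+ x
  e₄ = solve-∀
  e₅ : ∀ x → - x - - + 1 ≡ + 1 ℤ.+ - x
  e₅ = solve-∀
  at-R : h (- + R) ≡ false
  at-R = outside (- + R) (ℕP.≤-reflexive (sym (ℤP.∣-i∣≡∣i∣ (+ R))))
  slide : (s ≡ + 1 ⊎ s ≡ - + 1) → window (- + R - s) (suc (R + R)) h ≡ window (- + R) (suc (R + R)) h
  slide (inj₁ refl) =
    trans (window-slide (- + R - + 1) (R + R) h (trans (cong h (e₁ (+ R))) (outside -[1+ R ] (ℕP.n≤1+n R)))
                        (trans (cong h (trans (cong (ℤ._+ + suc (R + R)) (e₁ (+ R))) (e₂ (+ R)))) (outside (+ R) ℕP.≤-refl)))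
          (cong (λ x → window x (suc (R + R)) h) (e₃ (+ R)))
  slide (inj₂ refl) =
    trans (cong (λ x → window x (suc (R + R)) h) (e₅ (+ R)))
          (sym (window-slide (- + R) (R + R) h at-R (trans (cong h (e₄ (+ R))) (outside (+ suc R) (ℕP.n≤1+n R)))))

RowBounded : ℕ → Series₂ → Set
RowBounded k f = ∀ j n → k < ℤ.∣ j ∣ → f j n ≡ false

one₂-rows : RowBounded 0 one₂
one₂-rows (+ suc j) n _ = refl
one₂-rows -[1+ j ]  n _ = refl

mulBin₂-rows : ∀ s b k {f} → ℤ.∣ s ∣ ≡ 1 → RowBounded k f → RowBounded (suc k) (mulBin₂ s b f)
mulBin₂-rows s b k {f} ∣s∣≡1 rows j n k+1<∣j∣ =
  cong₂ _xor_ (rows j n (ℕP.<-trans (ℕP.n<1+n k) k+1<∣j∣)) (rows (j - s) (n - b) k<∣j-s∣)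
  where
  regroup : ∀ j s → j - s ℤ.+ s ≡ j
  regroup = solve-∀
  triangle : ℤ.∣ j ∣ ≤ ℤ.∣ j - s ∣ + 1
  triangle = subst₂ (λ x y → ℤ.∣ x ∣ ≤ ℤ.∣ j - s ∣ + y) (regroup j s) ∣s∣≡1 (ℤP.∣i+j∣≤∣i∣+∣j∣ (j - s) s)
  k<∣j-s∣ : k < ℤ.∣ j - s ∣
  k<∣j-s∣ = ℕP.≤-pred (subst (suc (suc k) ≤_) (ℕP.+-comm ℤ.∣ j - s ∣ 1) (ℕP.≤-trans k+1<∣j∣ triangle))

triple-rows : ∀ K → RowBounded (K + K) (triple K)
triple-rows zero    = one₂-rows
triple-rows (suc k) rewrite ℕP.+-suc k k =
  mulBin₂-rows (+ 1) (deg₃ k) (suc (k + k)) refl (mulBin₂-rows (- + 1) (deg₃ k) (k + k) refl (triple-rows k))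

-- spec R a F is F at z = q^a, keeping only |j| ≤ R.
spec : ℕ → ℤ → Series₂ → Series
spec R a f N = symΣ R (λ j → f j (N - a ℤ.* j))

spec-one₂ : ∀ R a → spec R a one₂ ≗ one
spec-one₂ R a N = trans (symΣ-even R _ (λ i → refl)) (trans (cong (one₂ 0ℤ) (regroup N a)) (row₀ N))
  where
  regroup : ∀ N a → N - a ℤ.* + 0 ≡ N
  regroup = solve-∀
  row₀ : ∀ N → one₂ 0ℤ N ≡ one N
  row₀ (+ zero)  = refl
  row₀ (+ suc n) = refl
  row₀ -[1+ n ]  = refl

spec-mulBin₂ : ∀ R a s b c {k} f → + c ≡ a ℤ.* s ℤ.+ b → (s ≡ + 1 ⊎ s ≡ - + 1) →
               RowBounded k f → k < R → spec R a (mulBin₂ s b f) ≗ mulBin c (spec R a f)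
spec-mulBin₂ R a s b c f c≡ unit rows k<R N =
  trans (symΣ-xor R (λ j → f j (N - a ℤ.* j)) (λ j → f (j - s) (N - a ℤ.* j - b)))
        (cong (spec R a f N xor_)
              (trans (symΣ-cong R (λ j _ → cong (f (j - s)) (regroup′ j)))
                     (symΣ-shift R s h unit (λ j R≤∣j∣ → rows j _ (ℕP.<-≤-trans k<R R≤∣j∣)))))
  where
  h : ℤ → Bool
  h j = f j (N - + c - a ℤ.* j)
  regroup : ∀ N a j s b → N - a ℤ.* j - b ≡ N - (a ℤ.* s ℤ.+ b) - a ℤ.* (j - s)
  regroup = solve-∀
  regroup′ : ∀ j → N - a ℤ.* j - b ≡ N - + c - a ℤ.* (j - s)
  regroup′ j = trans (regroup N a j s b) (cong (λ x → N - x - a ℤ.* (j - s)) (sym c≡))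

pairProd : (ℕ → ℕ) → (ℕ → ℕ) → ℕ → Series
pairProd c₁ c₂ zero    = one
pairProd c₁ c₂ (suc k) = mulBin (c₁ k) (mulBin (c₂ k) (pairProd c₁ c₂ k))

pairProd-power : ∀ c₁ c₂ K → PowerSeries (pairProd c₁ c₂ K)
pairProd-power c₁ c₂ zero    = one-power
pairProd-power c₁ c₂ (suc k) = mulBin-power (c₁ k) (mulBin-power (c₂ k) (pairProd-power c₁ c₂ k))

spec-triple : ∀ R a c₁ c₂ → (∀ k → + c₁ k ≡ a ℤ.* + 1 ℤ.+ deg₃ k) → (∀ k → + c₂ k ≡ a ℤ.* - + 1 ℤ.+ deg₃ k) →
              ∀ K → K + K < R → spec R a (triple K) ≗ pairProd c₁ c₂ K
spec-triple R a c₁ c₂ e₁ e₂ zero    _   = spec-one₂ R a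
spec-triple R a c₁ c₂ e₁ e₂ (suc k) k<R N =
  trans (spec-mulBin₂ R a (+ 1) (deg₃ k) (c₁ k) F (e₁ k) (inj₁ refl) F-rows F<R N)
        (mulBin-cong (c₁ k) (λ N′ → trans (spec-mulBin₂ R a (- + 1) (deg₃ k) (c₂ k) (triple k) (e₂ k) (inj₂ refl)
                                                         (triple-rows k) 2k<R N′)
                                           (mulBin-cong (c₂ k) (spec-triple R a c₁ c₂ e₁ e₂ k 2k<R) N′)) N)
  where
  F = mulBin₂ (- + 1) (deg₃ k) (triple k)
  F-rows : RowBounded (suc (k + k)) F
  F-rows = mulBin₂-rows (- + 1) (deg₃ k) (k + k) refl (triple-rows k)
  F<R : suc (k + k) < R
  F<R = ℕP.<-trans (ℕP.n<1+n _) (subst (_< R) (cong suc (ℕP.+-suc k k)) k<R)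
  2k<R : k + k < R
  2k<R = ℕP.<-trans (ℕP.n<1+n _) F<R

pos6 : ∀ k c → + (6 * k + c) ≡ + 6 ℤ.* + k ℤ.+ + c
pos6 k c = cong (ℤ._+ + c) (ℤP.pos-* 6 k)

Π₀ : ℕ → Series
Π₀ = pairProd (λ k → 6 * k + 3) (λ k → 6 * k + 3)

Π₂ : ℕ → Series
Π₂ = pairProd (λ k → 6 * k + 5) (λ k → 6 * k + 1)

spec₀-triple : ∀ K → spec (suc (K + K)) 0ℤ (triple K) ≗ Π₀ K
spec₀-triple K = spec-triple _ 0ℤ _ _ (λ k → trans (pos6 k 3) (e₊ (+ k))) (λ k → trans (pos6 k 3) (e₋ (+ k))) K ℕP.≤-refl
  where
  e₊ : ∀ x → + 6 ℤ.* x ℤ.+ + 3 ≡ 0ℤ ℤ.* + 1 ℤ.+ (+ 6 ℤ.* x ℤ.+ + 3)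
  e₊ = solve-∀
  e₋ : ∀ x → + 6 ℤ.* x ℤ.+ + 3 ≡ 0ℤ ℤ.* - + 1 ℤ.+ (+ 6 ℤ.* x ℤ.+ + 3)
  e₋ = solve-∀

spec₂-triple : ∀ K → spec (suc (K + K)) (+ 2) (triple K) ≗ Π₂ K
spec₂-triple K = spec-triple _ (+ 2) _ _ (λ k → trans (pos6 k 5) (e₊ (+ k))) (λ k → trans (pos6 k 1) (e₋ (+ k))) K ℕP.≤-refl
  where
  e₊ : ∀ x → + 6 ℤ.* x ℤ.+ + 5 ≡ + 2 ℤ.* + 1 ℤ.+ (+ 6 ℤ.* x ℤ.+ + 3)
  e₊ = solve-∀
  e₋ : ∀ x → + 6 ℤ.* x ℤ.+ + 1 ≡ + 2 ℤ.* - + 1 ℤ.+ (+ 6 ℤ.* x ℤ.+ + 3)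
  e₋ = solve-∀

-- At z = 1 the rows j and -j cancel in pairs mod 2.
Π₀-row₀ : ∀ K m → m ℤ.≤ + 6 ℤ.* + K → Π₀ K m ≡ triple K 0ℤ m
Π₀-row₀ K m m≤ = begin
  Π₀ K m                                        ≡⟨ sym (spec₀-triple K m) ⟩
  spec R 0ℤ (triple K) m
    ≡⟨ symΣ-cong R (λ j _ → trans (cong (triple K j) (e₁ m j)) (triple-coeff K j m m≤)) ⟩
  symΣ R (λ j → triple K 0ℤ (m - sq₃ j))         ≡⟨ symΣ-even R _ (λ i → cong (triple K 0ℤ) (e₂ m (+ i))) ⟩
  triple K 0ℤ (m - sq₃ 0ℤ)                       ≡⟨ cong (triple K 0ℤ) (e₃ m) ⟩
  triple K 0ℤ m                                  ∎
  where
  open ≡-Reasoning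
  R = suc (K + K)
  e₁ : ∀ m j → m - 0ℤ ℤ.* j ≡ m
  e₁ = solve-∀
  e₂ : ∀ m x → m - + 3 ℤ.* ((+ 1 ℤ.+ x) ℤ.* (+ 1 ℤ.+ x)) ≡ m - + 3 ℤ.* (- (+ 1 ℤ.+ x) ℤ.* - (+ 1 ℤ.+ x))
  e₂ = solve-∀
  e₃ : ∀ m → m - + 3 ℤ.* (0ℤ ℤ.* 0ℤ) ≡ m
  e₃ = solve-∀

thetaExp : ℤ → ℕ
thetaExp (+ i)     = 3 * (i * i) + 2 * i
thetaExp -[1+ i ] = 3 * (i * i) + 4 * i + 1

thetaExp-eq : ∀ j → + thetaExp j ≡ + 2 ℤ.* j ℤ.+ sq₃ j
thetaExp-eq (+ i)     = trans (cong₂ ℤ._+_ (sq i) (ℤP.pos-* 2 i)) (e (+ i))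
  where
  sq : ∀ i → + (3 * (i * i)) ≡ + 3 ℤ.* (+ i ℤ.* + i)
  sq i = trans (ℤP.pos-* 3 (i * i)) (cong (+ 3 ℤ.*_) (ℤP.pos-* i i))
  e : ∀ x → + 3 ℤ.* (x ℤ.* x) ℤ.+ + 2 ℤ.* x ≡ + 2 ℤ.* x ℤ.+ + 3 ℤ.* (x ℤ.* x)
  e = solve-∀
thetaExp-eq -[1+ i ] =
  trans (cong (ℤ._+ + 1) (cong₂ ℤ._+_ (trans (ℤP.pos-* 3 (i * i)) (cong (+ 3 ℤ.*_) (ℤP.pos-* i i))) (ℤP.pos-* 4 i)))
        (e (+ i))
  where
  e : ∀ x → + 3 ℤ.* (x ℤ.* x) ℤ.+ + 4 ℤ.* x ℤ.+ + 1
            ≡ + 2 ℤ.* - (+ 1 ℤ.+ x) ℤ.+ + 3 ℤ.* (- (+ 1 ℤ.+ x) ℤ.* - (+ 1 ℤ.+ x))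
  e = solve-∀

-- theta R h = h · Σ_{|j| ≤ R} q^(3j² + 2j).
theta : ℕ → Series → Series
theta R h m = symΣ R (λ j → h (m - + thetaExp j))

theta-cong : ∀ R {h h′} → h ≗ h′ → theta R h ≗ theta R h′
theta-cong R h≗h′ m = symΣ-cong R (λ j _ → h≗h′ _)

theta-mulBin : ∀ R c h → theta R (mulBin c h) ≗ mulBin c (theta R h)
theta-mulBin R c h m =
  trans (symΣ-xor R _ _) (cong (theta R h m xor_) (symΣ-cong R (λ j _ → cong h (sub-swap m (+ thetaExp j) (+ c)))))
  where
  sub-swap : ∀ m x y → (m - x) - y ≡ (m - y) - x
  sub-swap = solve-∀

theta-powBin : ∀ R e c h → theta R (powBin e c h) ≗ powBin e c (theta R h)
theta-powBin R zero    c h m = refl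
theta-powBin R (suc e) c h m = trans (theta-mulBin R c (powBin e c h) m) (mulBin-cong c (theta-powBin R e c h) m)

theta-prodBin : ∀ R e K h → theta R (prodBin e K h) ≗ prodBin e K (theta R h)
theta-prodBin R e zero    h m = refl
theta-prodBin R e (suc K) h m =
  trans (theta-powBin R (e (suc K)) (suc K) (prodBin e K h) m) (powBin-cong (e (suc K)) (suc K) (theta-prodBin R e K h) m)

theta-agree : ∀ R B {h h′} → AgreeUpTo B h h′ → AgreeUpTo B (theta R h) (theta R h′)
theta-agree R B h≈h′ m m≤B = symΣ-cong R (λ j _ → h≈h′ _ (ℤP.≤-trans (ℤP.i-j≤i m (+ thetaExp j)) m≤B))

≤⇒offset : ∀ {x y} → x ℤ.≤ y → ∃ λ d → y ≡ x ℤ.+ + d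
≤⇒offset {x} {y} x≤y =
  ℤ.∣ y - x ∣ , trans (e y x) (cong (λ z → x ℤ.+ z) (sym (ℤP.0≤i⇒+∣i∣≡i (ℤP.i≤j⇒0≤j-i x≤y))))
  where
  e : ∀ y x → y ≡ x ℤ.+ (y - x)
  e = solve-∀

shift-bound : ∀ {m b R j B} → m ℤ.≤ + b → - + R ℤ.≤ j → b + 2 * R ≤ B → m - + 2 ℤ.* j ℤ.≤ + B
shift-bound {m} {b} {R} {j} {B} m≤b -R≤j fits with ≤⇒offset -R≤j
... | d , refl = begin
  m - + 2 ℤ.* (- + R ℤ.+ + d)          ≡⟨ e m (+ R) (+ d) ⟩
  (m ℤ.+ + 2 ℤ.* + R) - + 2 ℤ.* + d    ≡⟨ cong (λ z → (m ℤ.+ + 2 ℤ.* + R) - z) (sym (ℤP.pos-* 2 d)) ⟩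
  (m ℤ.+ + 2 ℤ.* + R) - + (2 * d)      ≤⟨ ℤP.i-j≤i _ (+ (2 * d)) ⟩
  m ℤ.+ + 2 ℤ.* + R                    ≤⟨ ℤP.+-monoˡ-≤ (+ 2 ℤ.* + R) m≤b ⟩
  + b ℤ.+ + 2 ℤ.* + R                  ≡⟨ cong (λ z → + b ℤ.+ z) (sym (ℤP.pos-* 2 R)) ⟩
  + (b + 2 * R)                        ≤⟨ ℤ.+≤+ fits ⟩
  + B                                  ∎
  where
  open ℤP.≤-Reasoning
  e : ∀ m r d → m - + 2 ℤ.* (- r ℤ.+ d) ≡ (m ℤ.+ + 2 ℤ.* r) - + 2 ℤ.* d
  e = solve-∀

-- The triple product identity at z = q², in low degrees.
Π₂-theta : ∀ K b → b + 2 * suc (K + K) ≤ 6 * K → AgreeUpTo (+ b) (Π₂ K) (theta (suc (K + K)) (Π₀ K))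
Π₂-theta K b fits m m≤b = begin
  Π₂ K m                                    ≡⟨ sym (spec₂-triple K m) ⟩
  symΣ R (λ j → triple K j (m - + 2 ℤ.* j))  ≡⟨ symΣ-cong R row ⟩
  theta R (Π₀ K) m                          ∎
  where
  open ≡-Reasoning
  R = suc (K + K)
  6K : ℤ
  6K = + 6 ℤ.* + K
  m≤6K : m ℤ.≤ 6K
  m≤6K = ℤP.≤-trans m≤b (subst (+ b ℤ.≤_) (ℤP.pos-* 6 K) (ℤ.+≤+ (ℕP.≤-trans (ℕP.m≤m+n b _) fits)))
  e : ∀ m j → m - + 2 ℤ.* j - + 3 ℤ.* (j ℤ.* j) ≡ m - (+ 2 ℤ.* j ℤ.+ + 3 ℤ.* (j ℤ.* j))
  e = solve-∀
  row : ∀ j → - + R ℤ.≤ j → triple K j (m - + 2 ℤ.* j) ≡ Π₀ K (m - + thetaExp j)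
  row j -R≤j = begin
    triple K j (m - + 2 ℤ.* j)               ≡⟨ triple-coeff K j _ (subst (_ ℤ.≤_) (ℤP.pos-* 6 K) (shift-bound m≤b -R≤j fits)) ⟩
    triple K 0ℤ (m - + 2 ℤ.* j - sq₃ j)      ≡⟨ cong (triple K 0ℤ) (trans (e m j) (cong (λ z → m - z) (sym (thetaExp-eq j)))) ⟩
    triple K 0ℤ (m - + thetaExp j)           ≡⟨ sym (Π₀-row₀ K _ (ℤP.≤-trans (ℤP.i-j≤i m (+ thetaExp j)) m≤6K)) ⟩
    Π₀ K (m - + thetaExp j)                  ∎

periodic : (ℕ → ℕ) → ℕ → ℕ
periodic T a = T (a % 12)

blockProd : (ℕ → ℕ) → ℕ → ℕ → Series → Series
blockProd T k zero    g = g
blockProd T k (suc r) g = powBin (T (suc r % 12)) (suc r + k * 12) (blockProd T k r g)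

prodBin-periodic : ∀ T k r f → prodBin (periodic T) (r + k * 12) f ≗ blockProd T k r (prodBin (periodic T) (k * 12) f)
prodBin-periodic T k zero    f m = refl
prodBin-periodic T k (suc r) f m =
  trans (powBin-exp (suc r + k * 12) _ (cong T ([m+kn]%n≡m%n (suc r) k 12)) m)
        (powBin-cong (T (suc r % 12)) (suc r + k * 12) (prodBin-periodic T k r f) m)

_‼_ : List ℕ → ℕ → ℕ
[]       ‼ r     = 0
(x ∷ xs) ‼ zero  = x
(x ∷ xs) ‼ suc r = xs ‼ r

mulBin⁴-cong : ∀ {a a′ b b′ c c′ d d′ g h} → a ≡ a′ → b ≡ b′ → c ≡ c′ → d ≡ d′ → g ≗ h →
               mulBin a (mulBin b (mulBin c (mulBin d g))) ≗ mulBin a′ (mulBin b′ (mulBin c′ (mulBin d′ h)))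
mulBin⁴-cong {a} {b = b} {c = c} {d = d} refl refl refl refl g≗h =
  mulBin-cong a (mulBin-cong b (mulBin-cong c (mulBin-cong d g≗h)))

-- Exponents of (q^6; q^6), of (q; q^6) (q^5; q^6) and of (q^3; q^6)².
sixes units threes : ℕ → ℕ
sixes  r = (1 ∷ 0 ∷ 0 ∷ 0 ∷ 0 ∷ 0 ∷ 1 ∷ 0 ∷ 0 ∷ 0 ∷ 0 ∷ 0 ∷ []) ‼ r
units  r = (0 ∷ 1 ∷ 0 ∷ 0 ∷ 0 ∷ 1 ∷ 0 ∷ 1 ∷ 0 ∷ 0 ∷ 0 ∷ 1 ∷ []) ‼ r
threes r = (0 ∷ 0 ∷ 0 ∷ 2 ∷ 0 ∷ 0 ∷ 0 ∷ 0 ∷ 0 ∷ 2 ∷ 0 ∷ 0 ∷ []) ‼ r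

Π₀-periodic : ∀ k → Π₀ (k + k) ≗ prodBin (periodic threes) (k * 12) one
Π₀-periodic zero    m = refl
Π₀-periodic (suc k) m rewrite ℕP.+-suc k k =
  trans (mulBin⁴-cong (e₉ k) (e₉ k) (e₃ k) (e₃ k) (Π₀-periodic k) m)
        (sym (prodBin-periodic threes k 12 one m))
  where
  e₃ : ∀ k → 6 * (k + k) + 3 ≡ 3 + k * 12
  e₃ = ℕ-Solver.solve-∀
  e₉ : ∀ k → 6 * suc (k + k) + 3 ≡ 9 + k * 12
  e₉ = ℕ-Solver.solve-∀

Π₂-periodic : ∀ k → Π₂ (k + k) ≗ prodBin (periodic units) (k * 12) one
Π₂-periodic zero    m = refl
Π₂-periodic (suc k) m rewrite ℕP.+-suc k k =
  trans (mulBin⁴-cong (e₁₁ k) (e₇ k) (e₅ k) (e₁ k) (Π₂-periodic k) m)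
        (sym (prodBin-periodic units k 12 one m))
  where
  e₁ : ∀ k → 6 * (k + k) + 1 ≡ 1 + k * 12
  e₁ = ℕ-Solver.solve-∀
  e₅ : ∀ k → 6 * (k + k) + 5 ≡ 5 + k * 12
  e₅ = ℕ-Solver.solve-∀
  e₇ : ∀ k → 6 * suc (k + k) + 1 ≡ 7 + k * 12
  e₇ = ℕ-Solver.solve-∀
  e₁₁ : ∀ k → 6 * suc (k + k) + 5 ≡ 11 + k * 12
  e₁₁ = ℕ-Solver.solve-∀

mod-double : ∀ x b → (x + (b + b)) % 12 ≡ (x + (b % 12 + b % 12)) % 12
mod-double x b = begin
  (x + (b + b)) % 12                                 ≡⟨ cong (λ y → (x + (y + y)) % 12) (m≡m%n+[m/n]*n b 12) ⟩
  (x + ((r + q * 12) + (r + q * 12))) % 12           ≡⟨ cong (_% 12) (regroup x r q) ⟩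
  ((x + (r + r)) + (q + q) * 12) % 12                ≡⟨ [m+kn]%n≡m%n (x + (r + r)) (q + q) 12 ⟩
  (x + (r + r)) % 12                                 ∎
  where
  open ≡-Reasoning
  r = b % 12
  q = b / 12
  regroup : ∀ x r q → x + ((r + q * 12) + (r + q * 12)) ≡ (x + (r + r)) + (q + q) * 12
  regroup = ℕ-Solver.solve-∀

-- The hypotheses of descent for periodic exponents, on the residue r.
DescentSplit : (T T₁ T₂ : ℕ → ℕ) → ℕ → Set
DescentSplit T T₁ T₂ r =
  (T r ≡ T₁ r + (T₂ r + T₂ r)) × (T₁ ((r + r) % 12) + T₂ r ≡ T r) × (T₁ (suc (r + r) % 12) ≡ 0)

descentSplit? : ∀ T T₁ T₂ r → Dec (DescentSplit T T₁ T₂ r)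
descentSplit? T T₁ T₂ r = (T r ≟ _) ×-dec (_ ≟ T r) ×-dec (_ ≟ 0)

residues : ∀ {P : ℕ → Set} → (∀ (i : Fin 12) → P (toℕ i)) → ∀ r → r < 12 → P r
residues {P} all r r<12 = subst P (toℕ-fromℕ< r<12) (all (fromℕ< r<12))

periodic-descent : ∀ T T₁ T₂ K → (∀ (i : Fin 12) → DescentSplit T T₁ T₂ (toℕ i)) →
                   AgreeUpTo (+ K) (prodBin (periodic T) K one) one
periodic-descent T T₁ T₂ K check = descent (periodic T) (periodic T₁) (periodic T₂) K split (recombine ∘ suc)
  where
  check-at : ∀ b → DescentSplit T T₁ T₂ (b % 12)
  check-at b = residues {DescentSplit T T₁ T₂} check (b % 12) (m%n<n b 12)
  split : ∀ a → periodic T (suc a) ≡ periodic T₁ (suc a) + (periodic T₂ (suc a) + periodic T₂ (suc a))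
  split a = proj₁ (check-at (suc a))
  recombine : ∀ n → periodic T₁ n + dilate 0 (periodic T₂) n ≡ dilate 0 (periodic T) n
  recombine = parityℕ-elim _
    (λ b → begin
      T₁ ((b + b) % 12) + dilate 0 (periodic T₂) (b + b)   ≡⟨ cong₂ (λ x y → T₁ x + y) (mod-double 0 b) (dilate-even 0 _ b) ⟩
      T₁ ((b % 12 + b % 12) % 12) + T₂ (b % 12)           ≡⟨ proj₁ (proj₂ (check-at b)) ⟩
      T (b % 12)                                           ≡⟨ sym (dilate-even 0 _ b) ⟩
      dilate 0 (periodic T) (b + b)                        ∎)
    (λ b → begin
      T₁ (suc (b + b) % 12) + dilate 0 (periodic T₂) (suc (b + b)) ≡⟨ cong₂ (λ x y → T₁ x + y) (mod-double 1 b) (dilate-odd 0 _ b) ⟩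
      T₁ (suc (b % 12 + b % 12) % 12) + 0                  ≡⟨ cong (_+ 0) (proj₂ (proj₂ (check-at b))) ⟩
      0                                                    ≡⟨ sym (dilate-odd 0 _ b) ⟩
      dilate 0 (periodic T) (suc (b + b))                  ∎)
    where open ≡-Reasoning

-- The overpartition generating function

isOdd : ℕ → Bool
isOdd zero    = false
isOdd (suc n) = not (isOdd n)

isOdd-+ : ∀ a b → isOdd (a + b) ≡ isOdd a xor isOdd b
isOdd-+ zero    b = refl
isOdd-+ (suc a) b = trans (cong not (isOdd-+ a b)) (not-distribˡ-xor (isOdd a) (isOdd b))

isOdd-* : ∀ a b → isOdd (a * b) ≡ isOdd a ∧ isOdd b
isOdd-* zero    b = refl
isOdd-* (suc a) b rewrite isOdd-+ b (a * b) | isOdd-* a b with isOdd a | isOdd b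
... | true  | true  = refl
... | true  | false = refl
... | false | true  = refl
... | false | false = refl

isOdd-sum : ∀ (g f : ℕ → ℕ) L → isOdd (sum (map g (applyUpTo f L))) ≡ xorBelow (λ m → isOdd (g (f m))) L
isOdd-sum g f zero    = refl
isOdd-sum g f (suc L) = trans (isOdd-+ (g (f 0)) _) (cong (isOdd (g (f 0)) xor_) (isOdd-sum g (f ∘ suc) L))

%2-isOdd : ∀ a → a % 2 ≡ (if isOdd a then 1 else 0)
%2-isOdd zero          = refl
%2-isOdd (suc zero)    = refl
%2-isOdd (suc (suc a)) =
  trans (%2-isOdd a) (cong (λ b → if b then 1 else 0) (sym (not-involutive (isOdd a))))

isOdd-if : ∀ b x → isOdd (if b then x else 0) ≡ (if b then isOdd x else false)
isOdd-if true  x = refl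
isOdd-if false x = refl

≤ᵇ-false : ∀ a b → b < a → (a ≤ᵇ b) ≡ false
≤ᵇ-false a b b<a with a ≤ᵇ b in eq
... | false = refl
... | true  = ⊥-elim (ℕP.<⇒≱ b<a (ℕP.≤ᵇ⇒≤ a b (Equivalence.from T-≡ eq)))

≤ᵇ-+ : ∀ p x r → (p + x ≤ᵇ p + r) ≡ (x ≤ᵇ r)
≤ᵇ-+ zero    x r = refl
≤ᵇ-+ (suc p) x r = trans (≤ᵇ-suc (p + x) (p + r)) (≤ᵇ-+ p x r)
  where
  ≤ᵇ-suc : ∀ a b → (suc a ≤ᵇ suc b) ≡ (a ≤ᵇ b)
  ≤ᵇ-suc zero    b = refl
  ≤ᵇ-suc (suc a) b = refl

overSeries : ℕ → Series
overSeries k (+ n)     = isOdd (ovCount k n)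
overSeries k -[1+ n ] = false

overSeries-power : ∀ k → PowerSeries (overSeries k)
overSeries-power k = powerSeries λ d → refl

overSeries-zero : overSeries 0 ≗ one
overSeries-zero (+ zero)  = refl
overSeries-zero (+ suc n) = refl
overSeries-zero -[1+ n ]  = refl

residueWeight : ℕ → ℕ
residueWeight r = if r ≡ᵇ 0 then 0 else if (r ≡ᵇ 3) ∨ (r ≡ᵇ 9) then 2 else 1

-- Mod 2 the factor of the generating function for the part size p is 1 when the
-- weight of a positive multiplicity is even, and 1 / (1 + q^p) when it is odd.
overExp : ℕ → ℕ
overExp p = if isOdd (residueWeight (p % 12)) then 1 else 0

overExp-periodic : ∀ a → overExp a ≡ periodic overExp a
overExp-periodic a = cong (λ r → if isOdd (residueWeight r) then 1 else 0) (sym (m%n%n≡m%n a 12))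

summand : ℕ → ℕ → ℕ → ℕ
summand k n m = if m * suc k ≤ᵇ n then weight (suc k) m * ovCount k (n ∸ m * suc k) else 0

restParity : ℕ → ℕ → ℕ → Bool
restParity k n m = if m * suc k ≤ᵇ n then isOdd (ovCount k (n ∸ m * suc k)) else false

overSeries-suc : ∀ k n → overSeries (suc k) (+ n) ≡ xorBelow (isOdd ∘ summand k n) (suc n)
overSeries-suc k n = isOdd-sum (summand k n) (λ m → m) (suc n)

summand-zero : ∀ k n → isOdd (summand k n 0) ≡ isOdd (ovCount k n)
summand-zero k n = cong isOdd (ℕP.+-identityʳ (ovCount k n))

summand-odd : ∀ k → isOdd (weight (suc k) 1) ≡ true → ∀ n m → isOdd (summand k n m) ≡ restParity k n m
summand-odd k odd n zero    = summand-zero k n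
summand-odd k odd n (suc m) =
  trans (isOdd-if (suc m * suc k ≤ᵇ n) _)
        (cong (if suc m * suc k ≤ᵇ n then_else false)
              (trans (isOdd-* (weight (suc k) 1) _) (cong (_∧ isOdd (ovCount k (n ∸ suc m * suc k))) odd)))

summand-even : ∀ k → isOdd (weight (suc k) 1) ≡ false → ∀ n m → isOdd (summand k n (suc m)) ≡ false
summand-even k even n m with suc m * suc k ≤ᵇ n
... | false = refl
... | true  = trans (isOdd-* (weight (suc k) 1) _) (cong (_∧ isOdd (ovCount k (n ∸ suc m * suc k))) even)

restParity-beyond : ∀ k n m → n < m → restParity k n m ≡ false
restParity-beyond k n m n<m rewrite ≤ᵇ-false (m * suc k) n (ℕP.<-≤-trans n<m (ℕP.m≤m*n m (suc k))) = refl

restParity-small : ∀ k n m → n < suc k → restParity k n (suc m) ≡ false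
restParity-small k n m n<p rewrite ≤ᵇ-false (suc k + m * suc k) n (ℕP.<-≤-trans n<p (ℕP.m≤m+n (suc k) _)) = refl

restParity-shift : ∀ k r m → restParity k (suc k + r) (suc m) ≡ restParity k r m
restParity-shift k r m rewrite ≤ᵇ-+ (suc k) (m * suc k) r | ℕP.[m+n]∸[m+o]≡n∸o (suc k) r (m * suc k) = refl

overSeries-even : ∀ k → isOdd (weight (suc k) 1) ≡ false → overSeries (suc k) ≗ overSeries k
overSeries-even k even (+ n) =
  trans (overSeries-suc k n)
        (trans (cong₂ _xor_ (summand-zero k n) (xorBelow-false _ n (λ m _ → summand-even k even n m)))
               (xor-identityʳ _))
overSeries-even k even -[1+ n ] = refl

-- With an odd weight, the coefficients of degree n and n - p in overSeries p share
-- all the terms with at least one part p; only ovCount k n survives in their sum.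
overSeries-odd : ∀ k → isOdd (weight (suc k) 1) ≡ true → mulBin (suc k) (overSeries (suc k)) ≗ overSeries k
overSeries-odd k odd -[1+ n ] = refl
overSeries-odd k odd (+ n) with suc k ℕP.≤? n
... | no n<p rewrite sub-negative (suc k) (ℕP.≰⇒> n<p) =
  trans (cong (_xor false) (overSeries-suc k n))
  (trans (xor-identityʳ _)
  (trans (cong (isOdd (summand k n 0) xor_) (xorBelow-cong n (λ m _ → summand-odd k odd n (suc m))))
  (trans (cong₂ _xor_ (summand-zero k n) (xorBelow-false _ n (λ m _ → restParity-small k n m (ℕP.≰⇒> n<p))))
         (xor-identityʳ _))))
... | yes p≤n with ℕP.m≤n⇒∃[o]m+o≡n p≤n
...   | r , refl rewrite sub-nonneg (suc k) p≤n | ℕP.m+n∸m≡n (suc k) r = begin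
  overSeries (suc k) (+ (suc k + r)) xor overSeries (suc k) (+ r)
    ≡⟨ cong₂ _xor_ (overSeries-suc k (suc k + r)) (overSeries-suc k r) ⟩
  (isOdd (summand k (suc k + r) 0) xor xorBelow (isOdd ∘ summand k (suc k + r) ∘ suc) (suc k + r))
    xor xorBelow (isOdd ∘ summand k r) (suc r)
    ≡⟨ cong₂ (λ x y → (isOdd (summand k (suc k + r) 0) xor x) xor y)
             shifted (xorBelow-cong (suc r) (λ m _ → summand-odd k odd r m)) ⟩
  (isOdd (summand k (suc k + r) 0) xor xorBelow (restParity k r) (suc r)) xor xorBelow (restParity k r) (suc r)
    ≡⟨ xor-assoc (isOdd (summand k (suc k + r) 0)) (xorBelow (restParity k r) (suc r)) (xorBelow (restParity k r) (suc r)) ⟩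
  isOdd (summand k (suc k + r) 0) xor (xorBelow (restParity k r) (suc r) xor xorBelow (restParity k r) (suc r))
    ≡⟨ cong (isOdd (summand k (suc k + r) 0) xor_) (xor-same (xorBelow (restParity k r) (suc r))) ⟩
  isOdd (summand k (suc k + r) 0) xor false
    ≡⟨ trans (xor-identityʳ _) (summand-zero k (suc k + r)) ⟩
  overSeries k (+ (suc k + r)) ∎
  where
  open ≡-Reasoning
  shifted : xorBelow (isOdd ∘ summand k (suc k + r) ∘ suc) (suc k + r) ≡ xorBelow (restParity k r) (suc r)
  shifted = trans (xorBelow-cong {isOdd ∘ summand k (suc k + r) ∘ suc} {restParity k r} (suc k + r)
                                 (λ m _ → trans (summand-odd k odd (suc k + r) (suc m)) (restParity-shift k r m)))
                  (trans (cong (xorBelow (restParity k r)) (cong suc (ℕP.+-comm k r)))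
                         (xorBelow-beyond (restParity k r) r (restParity-beyond k r) k))

overSeries-rec : ∀ k → powBin (overExp (suc k)) (suc k) (overSeries (suc k)) ≗ overSeries k
overSeries-rec k with isOdd (weight (suc k) 1) in parity
... | true  = overSeries-odd k parity
... | false = overSeries-even k parity

overSeries-prod : ∀ K → prodBin overExp K (overSeries K) ≗ one
overSeries-prod zero          = overSeries-zero
overSeries-prod (suc K) m     =
  trans (sym (prodBin-powBin overExp K (overExp (suc K)) (suc K) (overSeries (suc K)) m))
        (trans (prodBin-cong overExp K (overSeries-rec K) m) (overSeries-prod K m))

overSeries-step : ∀ k n → n ≤ k → overSeries (suc k) (+ n) ≡ overSeries k (+ n)
overSeries-step k n n≤k with isOdd (weight (suc k) 1) in parity
... | false = overSeries-even k parity (+ n)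
... | true  = trans (sym (mulBin-high (suc k) (overSeries-power (suc k)) n (s≤s n≤k) (+ n) ℤP.≤-refl))
                    (overSeries-odd k parity (+ n))

overSeries-stable : ∀ d n → overSeries (n + d) (+ n) ≡ isOdd (Cbar12-3 n)
overSeries-stable zero    n rewrite ℕP.+-identityʳ n = refl
overSeries-stable (suc d) n rewrite ℕP.+-suc n d =
  trans (overSeries-step (n + d) n (ℕP.m≤m+n n d)) (overSeries-stable d n)

-- Roots of 3n + 1 and the theta series

isRoot : ℕ → ℕ → Bool
isRoot n k = k * k ≡ᵇ 3 * n + 1

squares-injective : ∀ m k → m * m ≡ k * k → m ≡ k
squares-injective m k eq with ℕP.<-cmp m k
... | tri< m<k _ _ = ⊥-elim (ℕP.<-irrefl eq (ℕP.*-mono-< m<k m<k))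
... | tri≈ _ m≡k _ = m≡k
... | tri> _ _ k<m = ⊥-elim (ℕP.<-irrefl (sym eq) (ℕP.*-mono-< k<m k<m))

isRoot-true : ∀ n k → isRoot n k ≡ true → k * k ≡ 3 * n + 1
isRoot-true n k root = ℕP.≡ᵇ⇒≡ (k * k) (3 * n + 1) (Equivalence.from T-≡ root)

isRoot-intro : ∀ n k → k * k ≡ 3 * n + 1 → isRoot n k ≡ true
isRoot-intro n k k²≡ = Equivalence.to T-≡ (ℕP.≡⇒≡ᵇ (k * k) (3 * n + 1) k²≡)

isRoot-unique : ∀ n k → k * k ≡ 3 * n + 1 → ∀ m → m ≢ k → isRoot n m ≡ false
isRoot-unique n k k²≡ m m≢k with isRoot n m in root
... | false = refl
... | true  = ⊥-elim (m≢k (squares-injective m k (trans (isRoot-true n m root) (sym k²≡))))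

≡ᵇ-iff : ∀ {a b c d} → (a ≡ b → c ≡ d) → (c ≡ d → a ≡ b) → (a ≡ᵇ b) ≡ (c ≡ᵇ d)
≡ᵇ-iff {a} {b} {c} {d} to from with a ≡ᵇ b in ab | c ≡ᵇ d in cd
... | true  | true  = refl
... | false | false = refl
... | true  | false = ⊥-elim (subst T cd (ℕP.≡⇒≡ᵇ c d (to (ℕP.≡ᵇ⇒≡ a b (Equivalence.from T-≡ ab)))))
... | false | true  = ⊥-elim (subst T ab (ℕP.≡⇒≡ᵇ a b (from (ℕP.≡ᵇ⇒≡ c d (Equivalence.from T-≡ cd)))))

one-⊖ : ∀ n T → one (n ⊖ T) ≡ (n ≡ᵇ T)
one-⊖ zero    zero    = refl
one-⊖ zero    (suc T) = refl
one-⊖ (suc n) zero    = refl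
one-⊖ (suc n) (suc T) = trans (cong one (ℤP.[1+m]⊖[1+n]≡m⊖n n T)) (one-⊖ n T)

theta-term : ∀ n T k → k * k ≡ 3 * T + 1 → one (+ n - + T) ≡ isRoot n k
theta-term n T k k²≡ = begin
  one (+ n - + T)               ≡⟨ cong one (ℤP.m-n≡m⊖n n T) ⟩
  one (n ⊖ T)                   ≡⟨ one-⊖ n T ⟩
  (n ≡ᵇ T)                      ≡⟨ ≡ᵇ-iff {n} {T} (λ n≡T → trans k²≡ (cong (λ x → 3 * x + 1) (sym n≡T)))
                                                  (λ k²≡′ → sym (cancel {T} {n} (trans (sym k²≡) k²≡′))) ⟩
  (k * k ≡ᵇ 3 * n + 1)          ∎
  where
  open ≡-Reasoning
  cancel : ∀ {a b} → 3 * a + 1 ≡ 3 * b + 1 → a ≡ b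
  cancel {a} {b} eq = ℕP.*-cancelˡ-≡ a b 3 (ℕP.+-cancelʳ-≡ 1 (3 * a) (3 * b) eq)

isRoot-multiple-of-3 : ∀ n i → isRoot n (3 * i) ≡ false
isRoot-multiple-of-3 n i with isRoot n (3 * i) in root
... | false = refl
... | true  = ⊥-elim (0≢1 (begin
  0                                  ≡⟨ sym ([m+kn]%n≡m%n 0 (3 * (i * i)) 3) ⟩
  (3 * (i * i) * 3) % 3              ≡⟨ cong (_% 3) (trans (e₁ i) (trans (isRoot-true n (3 * i) root) (e₂ n))) ⟩
  (1 + n * 3) % 3                    ≡⟨ [m+kn]%n≡m%n 1 n 3 ⟩
  1                                  ∎))
  where
  open ≡-Reasoning
  0≢1 : 0 ≡ 1 → ⊥
  0≢1 ()
  e₁ : ∀ i → 3 * (i * i) * 3 ≡ 3 * i * (3 * i)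
  e₁ = ℕ-Solver.solve-∀
  e₂ : ∀ n → 3 * n + 1 ≡ 1 + n * 3
  e₂ = ℕ-Solver.solve-∀

xor-regroup : ∀ x a b → x xor (a xor b) ≡ ((x xor b) xor false) xor a
xor-regroup x a b = begin
  x xor (a xor b)              ≡⟨ cong (x xor_) (xor-comm a b) ⟩
  x xor (b xor a)              ≡⟨ sym (xor-assoc x b a) ⟩
  (x xor b) xor a              ≡⟨ cong (_xor a) (sym (xor-identityʳ (x xor b))) ⟩
  ((x xor b) xor false) xor a  ∎
  where open ≡-Reasoning

-- The rows j = R + 1 and j = -(R + 1) of the theta series correspond to the roots
-- 3R + 4 and 3R + 2, and no root is divisible by 3.
theta-one : ∀ n R → theta R one (+ n) ≡ xorBelow (isRoot n) (3 * R + 2)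
theta-one n zero    =
  trans (theta-term n 0 1 refl)
        (sym (trans (cong (_xor (isRoot n 1 xor false)) (isRoot-multiple-of-3 n 0)) (xor-identityʳ (isRoot n 1))))
theta-one n (suc R) = begin
  theta R one (+ n) xor (one (+ n - + thetaExp (+ suc R)) xor one (+ n - + thetaExp -[1+ R ]))
    ≡⟨ cong₂ _xor_ (theta-one n R)
                   (cong₂ _xor_ (trans (theta-term n (thetaExp (+ suc R)) (3 * suc R + 1) (e₁ R)) (cong (isRoot n) (e₂ R)))
                                (theta-term n (thetaExp -[1+ R ]) (3 * R + 2) (e₃ R))) ⟩
  xorBelow f L xor (f (suc (suc L)) xor f L)
    ≡⟨ xor-regroup (xorBelow f L) (f (suc (suc L))) (f L) ⟩
  ((xorBelow f L xor f L) xor false) xor f (suc (suc L))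
    ≡⟨ cong (λ x → ((xorBelow f L xor f L) xor x) xor f (suc (suc L)))
            (sym (trans (cong f (e₄ R)) (isRoot-multiple-of-3 n (suc R)))) ⟩
  ((xorBelow f L xor f L) xor f (suc L)) xor f (suc (suc L))
    ≡⟨ sym (trans (xorBelow-snoc f (suc (suc L)))
                  (cong (_xor f (suc (suc L))) (trans (xorBelow-snoc f (suc L)) (cong (_xor f (suc L)) (xorBelow-snoc f L))))) ⟩
  xorBelow f (suc (suc (suc L)))
    ≡⟨ cong (xorBelow f) (e₅ R) ⟩
  xorBelow f (3 * suc R + 2) ∎
  where
  open ≡-Reasoning
  f = isRoot n
  L = 3 * R + 2
  e₁ : ∀ R → (3 * suc R + 1) * (3 * suc R + 1) ≡ 3 * (3 * (suc R * suc R) + 2 * suc R) + 1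
  e₁ = ℕ-Solver.solve-∀
  e₂ : ∀ R → 3 * suc R + 1 ≡ suc (suc (3 * R + 2))
  e₂ = ℕ-Solver.solve-∀
  e₃ : ∀ R → (3 * R + 2) * (3 * R + 2) ≡ 3 * (3 * (R * R) + 4 * R + 1) + 1
  e₃ = ℕ-Solver.solve-∀
  e₄ : ∀ R → suc (3 * R + 2) ≡ 3 * suc R
  e₄ = ℕ-Solver.solve-∀
  e₅ : ∀ R → suc (suc (suc (3 * R + 2))) ≡ 3 * suc R + 2
  e₅ = ℕ-Solver.solve-∀

overSixesUnits sixesThrees : ℕ → ℕ
overSixesUnits r = overExp r + (sixes r + units r)
sixesThrees    r = sixes r + threes r

overSixesUnits-trivial : ∀ N → AgreeUpTo (+ N) (prodBin (periodic overSixesUnits) N one) one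
overSixesUnits-trivial N =
  periodic-descent overSixesUnits T₁ T₂ N (from-yes (all? {12} (descentSplit? overSixesUnits T₁ T₂ ∘ toℕ)))
  where
  T₁ T₂ : ℕ → ℕ
  T₁ r = (1 ∷ 0 ∷ 1 ∷ 0 ∷ 1 ∷ 0 ∷ 0 ∷ 0 ∷ 1 ∷ 0 ∷ 1 ∷ 0 ∷ []) ‼ r
  T₂ r = (0 ∷ 1 ∷ 0 ∷ 0 ∷ 0 ∷ 1 ∷ 1 ∷ 1 ∷ 0 ∷ 0 ∷ 0 ∷ 1 ∷ []) ‼ r

sixesThrees-trivial : ∀ N → AgreeUpTo (+ N) (prodBin (periodic sixesThrees) N one) one
sixesThrees-trivial N =
  periodic-descent sixesThrees T₁ T₂ N (from-yes (all? {12} (descentSplit? sixesThrees T₁ T₂ ∘ toℕ)))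
  where
  T₁ T₂ : ℕ → ℕ
  T₁ r = (1 ∷ 0 ∷ 0 ∷ 0 ∷ 0 ∷ 0 ∷ 1 ∷ 0 ∷ 0 ∷ 0 ∷ 0 ∷ 0 ∷ []) ‼ r
  T₂ r = (0 ∷ 0 ∷ 0 ∷ 1 ∷ 0 ∷ 0 ∷ 0 ∷ 0 ∷ 0 ∷ 1 ∷ 0 ∷ 0 ∷ []) ‼ r

module _ (n : ℕ) where

  -- Any large enough truncation works; this one keeps all the bounds linear in n.
  private
    K N R : ℕ
    K = suc n + suc n
    N = suc n * 12
    R = suc (K + K)

    n≤N : n ≤ N
    n≤N = ℕP.≤-trans (ℕP.m≤m+n n (11 * n + 12)) (ℕP.≤-reflexive (sym (e n)))
      where
      e : ∀ n → suc n * 12 ≡ n + (11 * n + 12)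
      e = ℕ-Solver.solve-∀

    fits : n + 2 * R ≤ 6 * K
    fits = ℕP.≤-trans (ℕP.m≤m+n (n + 2 * R) (3 * n + 2)) (ℕP.≤-reflexive (sym (e n)))
      where
      e : ∀ n → 6 * (suc n + suc n) ≡ (n + 2 * suc ((suc n + suc n) + (suc n + suc n))) + (3 * n + 2)
      e = ℕ-Solver.solve-∀

    jacobi : Series
    jacobi = prodBin (periodic sixes) N (Π₂ K)

    jacobi-trivial : AgreeUpTo (+ N) (prodBin overExp N jacobi) one
    jacobi-trivial m m≤N = begin
      prodBin overExp N jacobi m
        ≡⟨ prodBin-cong overExp N (prodBin-cong (periodic sixes) N (Π₂-periodic (suc n))) m ⟩
      prodBin overExp N (prodBin (periodic sixes) N (prodBin (periodic units) N one)) m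
        ≡⟨ prodBin-cong overExp N (prodBin-merge (periodic sixes) (periodic units) N one) m ⟩
      prodBin overExp N (prodBin (periodic sixes ⊞ periodic units) N one) m
        ≡⟨ prodBin-merge overExp (periodic sixes ⊞ periodic units) N one m ⟩
      prodBin (overExp ⊞ (periodic sixes ⊞ periodic units)) N one m
        ≡⟨ prodBin-exp (overExp ⊞ (periodic sixes ⊞ periodic units)) (periodic overSixesUnits) N one
                       (λ a → cong (_+ (periodic sixes ⊞ periodic units) (suc a)) (overExp-periodic (suc a))) m ⟩
      prodBin (periodic overSixesUnits) N one m
        ≡⟨ overSixesUnits-trivial N m m≤N ⟩
      one m ∎
      where open ≡-Reasoning

    overSeries≈jacobi : AgreeUpTo (+ N) (overSeries N) jacobi
    overSeries≈jacobi = prodBin-injective overExp N (+ N) (overSeries-power N)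
                          (prodBin-power (periodic sixes) N (pairProd-power _ _ K))
                          (λ m m≤N → trans (overSeries-prod N m) (sym (jacobi-trivial m m≤N)))

    jacobi≈theta : jacobi (+ n) ≡ theta R one (+ n)
    jacobi≈theta = begin
      prodBin (periodic sixes) N (Π₂ K) (+ n)
        ≡⟨ prodBin-agree (periodic sixes) N (+ n) (Π₂-theta K n fits) (+ n) ℤP.≤-refl ⟩
      prodBin (periodic sixes) N (theta R (Π₀ K)) (+ n)
        ≡⟨ sym (theta-prodBin R (periodic sixes) N (Π₀ K) (+ n)) ⟩
      theta R (prodBin (periodic sixes) N (Π₀ K)) (+ n)
        ≡⟨ theta-cong R (prodBin-cong (periodic sixes) N (Π₀-periodic (suc n))) (+ n) ⟩
      theta R (prodBin (periodic sixes) N (prodBin (periodic threes) N one)) (+ n)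
        ≡⟨ theta-cong R (prodBin-merge (periodic sixes) (periodic threes) N one) (+ n) ⟩
      theta R (prodBin (periodic sixesThrees) N one) (+ n)
        ≡⟨ theta-agree R (+ N) (sixesThrees-trivial N) (+ n) (ℤ.+≤+ n≤N) ⟩
      theta R one (+ n) ∎
      where open ≡-Reasoning

  rootBound : ℕ
  rootBound = 3 * R + 2

  cbar-parity : isOdd (Cbar12-3 n) ≡ xorBelow (isRoot n) rootBound
  cbar-parity = begin
    isOdd (Cbar12-3 n)                    ≡⟨ sym (overSeries-stable (11 * n + 12) n) ⟩
    overSeries (n + (11 * n + 12)) (+ n)  ≡⟨ cong (λ x → overSeries x (+ n)) (e n) ⟩
    overSeries N (+ n)                    ≡⟨ overSeries≈jacobi (+ n) (ℤ.+≤+ n≤N) ⟩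
    jacobi (+ n)                          ≡⟨ jacobi≈theta ⟩
    theta R one (+ n)                     ≡⟨ theta-one n R ⟩
    xorBelow (isRoot n) rootBound         ∎
    where
    open ≡-Reasoning
    e : ∀ n → n + (11 * n + 12) ≡ suc n * 12
    e = ℕ-Solver.solve-∀

  root-below : ∀ k → k * k ≡ 3 * n + 1 → k < rootBound
  root-below k k²≡ =
    ℕP.≤-<-trans (ℕP.≤-trans (subst (k ≤_) k²≡ (k≤k*k k))
                             (ℕP.≤-trans (ℕP.m≤m+n (3 * n + 1) (9 * n + 15)) (ℕP.≤-reflexive (e n))))
                 (ℕP.+-monoʳ-< (3 * R) (s≤s (s≤s z≤n)))
    where
    k≤k*k : ∀ k → k ≤ k * k
    k≤k*k zero    = z≤n
    k≤k*k (suc k) = ℕP.m≤m*n (suc k) (suc k)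
    e : ∀ n → 3 * n + 1 + (9 * n + 15) ≡ 3 * suc ((suc n + suc n) + (suc n + suc n)) + 1
    e = ℕ-Solver.solve-∀

corollary3p2 : (n : ℕ) → 1 ≤ n →
    ((∃ λ k → k * k ≡ 3 * n + 1) → Cbar12-3 n % 2 ≡ 1) ×
    (¬ (∃ λ k → k * k ≡ 3 * n + 1) → Cbar12-3 n % 2 ≡ 0)
corollary3p2 n _ = square , nonsquare
  where
  parity-is : ∀ {b} → xorBelow (isRoot n) (rootBound n) ≡ b → Cbar12-3 n % 2 ≡ (if b then 1 else 0)
  parity-is roots = trans (%2-isOdd (Cbar12-3 n)) (cong (λ b → if b then 1 else 0) (trans (cbar-parity n) roots))
  square : (∃ λ k → k * k ≡ 3 * n + 1) → Cbar12-3 n % 2 ≡ 1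
  square (k , k²≡) =
    parity-is (xorBelow-single (isRoot n) (rootBound n) k
                 (isRoot-intro n k k²≡) (isRoot-unique n k k²≡) (root-below n k k²≡))
  nonsquare : ¬ (∃ λ k → k * k ≡ 3 * n + 1) → Cbar12-3 n % 2 ≡ 0
  nonsquare no-root with xorBelow (isRoot n) (rootBound n) in roots
  ... | false = parity-is roots
  ... | true  with xorBelow-true (isRoot n) (rootBound n) roots
  ...   | k , root = ⊥-elim (no-root (k , isRoot-true n k root))
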